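{- Let $\{\{\vec{0}\},A,B,C,D\}$ be a partition of $AG(4,3)$ into four mutually disjoint maximal caps together with their common anchor point $\vec{0}$. (1) If $B$ is $A$-1-completable or $A$-2-completable, then $D$ is $C$-1-completable or $C$-2-completable. (2) $\{A,B\}$ is a 1-completable pair if and only if $\{C,D\}$ is a 1-completable pair; likewise $\{A,B\}$ is a 2-completable pair if and only if $\{C,D\}$ is a 2-completable pair.
   Context: $AG(4,3)$ is $\mathbb{F}_3^4$; lines are sets $\{\vec{x},\vec{y},\vec{z}\}$ of three distinct points with $\vec{x}+\vec{y}+\vec{z}=\vec{0}$ mod 3. A cap is a set with no three collinear points; a maximal cap is a cap of largest size (20 points). Every maximal cap $S$ has a unique anchor point $\vec{a}\notin S$: $S$ is a union of 10 pairs of points each forming a line with $\vec{a}$. A partition of $AG(4,3)$ with anchor $\vec{0}$ is a collection $\{\{\vec{0}\},A,B,C,D\}$ where $A,B,C,D$ are mutually disjoint maximal caps each with anchor $\vec{0}$ and whose union with $\{\vec{0}\}$ is $AG(4,3)$. For disjoint maximal caps $X,Y$ with anchor $\vec{0}$, $Y$ is $X$-$k$-completable if exactly $k$ partitions contain both $X$ and $Y$ (this relation is symmetric, and $k\in\{1,2,6\}$ always); the pair $\{X,Y\}$ is called a 1-completable pair (resp. 2-completable pair) if it appears in exactly one (resp. exactly two) partitions. -}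

module Defs where

open import Data.Nat using (ℕ; _≤_)
open import Data.Fin using (Fin; zero; suc)
open import Data.Vec using (Vec; []; _∷_; zipWith; map; replicate)
open import Data.Bool using (Bool; true; false)
open import Data.List using (List; []; _∷_; length; filter; concatMap; allFin)
import Data.List as L
open import Data.Product using (Σ; _×_; _,_)
open import Data.Sum using (_⊎_)
open import Data.List.Relation.Unary.All using (All)
open import Data.List.Relation.Unary.Any using (Any)
open import Data.List.Relation.Unary.AllPairs using (AllPairs)
open import Relation.Binary.PropositionalEquality using (_≡_; _≢_)
open import Relation.Nullary using (¬_)

F3 : Set
F3 = Fin 3

_+₃_ : F3 → F3 → F3
zero +₃ y = y
suc zero +₃ zero = suc zero
suc zero +₃ suc zero = suc (suc zero)
suc zero +₃ suc (suc zero) = zero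
suc (suc zero) +₃ zero = suc (suc zero)
suc (suc zero) +₃ suc zero = zero
suc (suc zero) +₃ suc (suc zero) = suc zero

-₃_ : F3 → F3
-₃ zero = zero
-₃ suc zero = suc (suc zero)
-₃ suc (suc zero) = suc zero

Point : Set
Point = Vec F3 4

_⊕_ : Point → Point → Point
_⊕_ = zipWith _+₃_

⊖_ : Point → Point
⊖_ = map -₃_

𝟘 : Point
𝟘 = replicate 4 zero

allVecs : (n : ℕ) → List (Vec F3 n)
allVecs ℕ.zero = [] ∷ []
allVecs (ℕ.suc n) = concatMap (λ a → L.map (a ∷_) (allVecs n)) (allFin 3)

allPoints : List Point
allPoints = allVecs 4

PSet : Set
PSet = Point → Bool

_∈ₛ_ : Point → PSet → Set
x ∈ₛ S = S x ≡ true

size : PSet → ℕ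
size S = length (filter (λ x → Data.Bool._≟_ (S x) true) allPoints)
  where import Data.Bool

_≐_ : PSet → PSet → Set
S ≐ T = ∀ x → S x ≡ T x

IsLine : Point → Point → Point → Set
IsLine x y z = x ≢ y × y ≢ z × x ≢ z × ((x ⊕ y) ⊕ z) ≡ 𝟘

IsCap : PSet → Set
IsCap S = ∀ x y z → x ∈ₛ S → y ∈ₛ S → z ∈ₛ S → ¬ IsLine x y z

IsMaxCap : PSet → Set
IsMaxCap S = IsCap S × (∀ T → IsCap T → size T ≤ size S)

-- a is an anchor of S: a ∉ S and S is a union of pairs {x,y} with {x,y,a} a line,
-- i.e. for every x ∈ S the third point y = -(a+x) of the line through a and x is in S.
HasAnchor : Point → PSet → Set
HasAnchor a S = ¬ (a ∈ₛ S) × (∀ x → x ∈ₛ S → (⊖ (a ⊕ x)) ∈ₛ S)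

MaxCap0 : PSet → Set
MaxCap0 S = IsMaxCap S × HasAnchor 𝟘 S

Disjoint : PSet → PSet → Set
Disjoint S T = ∀ x → ¬ (x ∈ₛ S × x ∈ₛ T)

IsPartition0 : PSet → PSet → PSet → PSet → Set
IsPartition0 A B C D =
  MaxCap0 A × MaxCap0 B × MaxCap0 C × MaxCap0 D ×
  Disjoint A B × Disjoint A C × Disjoint A D ×
  Disjoint B C × Disjoint B D × Disjoint C D ×
  (∀ x → x ≡ 𝟘 ⊎ x ∈ₛ A ⊎ x ∈ₛ B ⊎ x ∈ₛ C ⊎ x ∈ₛ D)

-- Two completions (C,D), (C',D') give the same partition iff {C,D} = {C',D'}.
SamePair : PSet × PSet → PSet × PSet → Set
SamePair (C , D) (C' , D') = (C ≐ C' × D ≐ D') ⊎ (C ≐ D' × D ≐ C')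

Completes : PSet → PSet → PSet × PSet → Set
Completes X Y (C , D) = IsPartition0 X Y C D

-- Exactly k partitions contain both X and Y: a duplicate-free list of k
-- completions {C,D} (as unordered pairs) containing every completion.
Completable : ℕ → PSet → PSet → Set
Completable k X Y =
  Σ (List (PSet × PSet)) λ Ls →
    length Ls ≡ k ×
    All (Completes X Y) Ls ×
    AllPairs (λ p q → ¬ SamePair p q) Ls ×
    (∀ C D → IsPartition0 X Y C D → Any (SamePair (C , D)) Ls)

-- All three claims follow from one transfer statement (count-transfer): in
-- every partition {𝟘,A,B,C,D}, if {A,B} lies in exactly k partitions then so
-- does {C,D}.  Applied to {A,B} → {C,D} and to {C,D} → {A,B} it gives the
-- lemma, which is proved last.
--
-- The transfer property is invariant under linear automorphisms of F₃⁴ and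
-- under replacing caps by extensionally equal sets (transfer-preimage,
-- transfer-≐), and completion counts are well defined (completable-unique).
-- So a partition may be normalised: a basis e₁,…,e₄ is moved into A (extend),
-- a verified exhaustive cap search then identifies A with a fixed cap A₀
-- (classify-onto), a point p₀ is moved into B by the stabiliser of A₀
-- (move-into-B), and the search identifies (A,B) with one of three normal
-- forms (A₀,Bᵣ) (classify-pair).  For these, the completions {C,D} of
-- {A₀,Bᵣ}, and the completions of each such {C,D}, are counted exactly by the
-- search (transfer-certified).

module Submission where

open import Defs
open import Data.Nat as ℕ using (ℕ; zero; suc; _≤_; _<_; z≤n; s≤s; _+_; _*_; _≡ᵇ_; _≤ᵇ_; _/_; _%_)
import Data.Nat.Properties as ℕₚ
open import Data.Fin using (Fin; zero; suc; toℕ)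
import Data.Fin.Properties as Finₚ
open import Data.Vec as Vec using (Vec; []; _∷_; zipWith)
import Data.Vec.Properties as Vecₚ
open import Data.Bool using (Bool; true; false; _∧_; _∨_; not; T) renaming (_≟_ to _≟𝔹_)
import Data.Bool.Properties as Boolₚ
open import Data.Bool.ListAction using (all; any)
open import Data.List as List using (List; []; _∷_; length; _++_; null; filter)
import Data.List.Properties as Listₚ
open import Data.List.Relation.Unary.Any as Any using (Any; here; there)
import Data.List.Relation.Unary.Any.Properties as Anyₚ
open import Data.List.Relation.Unary.All as All using (All; []; _∷_)
import Data.List.Relation.Unary.All.Properties as Allₚ
open import Data.List.Relation.Unary.AllPairs as AllPairs using (AllPairs; []; _∷_)
import Data.List.Relation.Unary.AllPairs.Properties as AllPairsₚ
open import Data.List.Relation.Unary.Unique.Propositional using (Unique)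
import Data.List.Relation.Unary.Unique.Propositional.Properties as Uniqueₚ
import Data.List.Relation.Unary.Unique.DecPropositional as UniqueDec
open import Data.List.Membership.Propositional using (_∈_; find; lose)
import Data.List.Membership.Propositional.Properties as ∈ₚ
open import Data.Product using (Σ; _×_; _,_; proj₁; proj₂; ∃)
open import Data.Sum as Sum using (_⊎_; inj₁; inj₂)
open import Data.Empty using (⊥-elim)
open import Relation.Binary.PropositionalEquality
open import Relation.Nullary using (¬_; Dec)
open import Relation.Nullary.Decidable using (from-yes; _→-dec_)
open import Function.Bundles using (_⇔_; mk⇔)

_*₃_ : F3 → F3 → F3
zero *₃ b = zero
suc zero *₃ b = b
suc (suc zero) *₃ b = -₃ b

+₃-comm : ∀ a b → a +₃ b ≡ b +₃ a
+₃-comm = from-yes (Finₚ.all? λ a → Finₚ.all? λ b → (a +₃ b) Finₚ.≟ (b +₃ a))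

+₃-assoc : ∀ a b c → (a +₃ b) +₃ c ≡ a +₃ (b +₃ c)
+₃-assoc = from-yes (Finₚ.all? λ a → Finₚ.all? λ b → Finₚ.all? λ c →
  ((a +₃ b) +₃ c) Finₚ.≟ (a +₃ (b +₃ c)))

+₃-inverseʳ : ∀ a → a +₃ (-₃ a) ≡ zero
+₃-inverseʳ = from-yes (Finₚ.all? λ a → (a +₃ (-₃ a)) Finₚ.≟ zero)

-₃-involutive : ∀ a → -₃ (-₃ a) ≡ a
-₃-involutive = from-yes (Finₚ.all? λ a → (-₃ (-₃ a)) Finₚ.≟ a)

-₃-distrib : ∀ a b → -₃ (a +₃ b) ≡ (-₃ a) +₃ (-₃ b)
-₃-distrib = from-yes (Finₚ.all? λ a → Finₚ.all? λ b → (-₃ (a +₃ b)) Finₚ.≟ ((-₃ a) +₃ (-₃ b)))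

*₃-distribʳ : ∀ a b c → (a +₃ b) *₃ c ≡ (a *₃ c) +₃ (b *₃ c)
*₃-distribʳ = from-yes (Finₚ.all? λ a → Finₚ.all? λ b → Finₚ.all? λ c →
  ((a +₃ b) *₃ c) Finₚ.≟ ((a *₃ c) +₃ (b *₃ c)))

*₃-negˡ : ∀ a c → (-₃ a) *₃ c ≡ -₃ (a *₃ c)
*₃-negˡ = from-yes (Finₚ.all? λ a → Finₚ.all? λ c → ((-₃ a) *₃ c) Finₚ.≟ (-₃ (a *₃ c)))

-- In characteristic 3, a = -(a + b) forces b = a (since 3a + b = 0 reads b = a).
self-third : ∀ a b → a ≡ -₃ (a +₃ b) → b ≡ a
self-third = from-yes (Finₚ.all? λ a → Finₚ.all? λ b →
  (a Finₚ.≟ (-₃ (a +₃ b))) →-dec (b Finₚ.≟ a))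

⊕-comm : ∀ x y → x ⊕ y ≡ y ⊕ x
⊕-comm = Vecₚ.zipWith-comm +₃-comm

⊕-assoc : ∀ x y z → (x ⊕ y) ⊕ z ≡ x ⊕ (y ⊕ z)
⊕-assoc = Vecₚ.zipWith-assoc +₃-assoc

⊕-identityˡ : ∀ x → 𝟘 ⊕ x ≡ x
⊕-identityˡ = Vecₚ.zipWith-identityˡ (λ _ → refl)

⊕-inverseʳ : ∀ x → x ⊕ (⊖ x) ≡ 𝟘
⊕-inverseʳ = Vecₚ.zipWith-inverseʳ +₃-inverseʳ

⊖-involutive : ∀ x → ⊖ (⊖ x) ≡ x
⊖-involutive x =
  trans (sym (Vecₚ.map-∘ -₃_ -₃_ x)) (trans (Vecₚ.map-cong -₃-involutive x) (Vecₚ.map-id x))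

⊖-distrib : ∀ {n} (x y : Vec F3 n) →
  Vec.map -₃_ (zipWith _+₃_ x y) ≡ zipWith _+₃_ (Vec.map -₃_ x) (Vec.map -₃_ y)
⊖-distrib [] [] = refl
⊖-distrib (a ∷ x) (b ∷ y) = cong₂ _∷_ (-₃-distrib a b) (⊖-distrib x y)

⊕-interchange : ∀ a b c d → (a ⊕ b) ⊕ (c ⊕ d) ≡ (a ⊕ c) ⊕ (b ⊕ d)
⊕-interchange a b c d = begin
  (a ⊕ b) ⊕ (c ⊕ d)  ≡⟨ ⊕-assoc a b (c ⊕ d) ⟩
  a ⊕ (b ⊕ (c ⊕ d))  ≡⟨ cong (a ⊕_) (sym (⊕-assoc b c d)) ⟩
  a ⊕ ((b ⊕ c) ⊕ d)  ≡⟨ cong (λ t → a ⊕ (t ⊕ d)) (⊕-comm b c) ⟩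
  a ⊕ ((c ⊕ b) ⊕ d)  ≡⟨ cong (a ⊕_) (⊕-assoc c b d) ⟩
  a ⊕ (c ⊕ (b ⊕ d))  ≡⟨ sym (⊕-assoc a c (b ⊕ d)) ⟩
  (a ⊕ c) ⊕ (b ⊕ d)  ∎
  where open ≡-Reasoning

third-point : ∀ x y z → (x ⊕ y) ⊕ z ≡ 𝟘 → z ≡ ⊖ (x ⊕ y)
third-point x y z sum≡𝟘 = begin
  z                                  ≡⟨ sym (⊕-identityˡ z) ⟩
  𝟘 ⊕ z                              ≡⟨ cong (_⊕ z) (sym (⊕-inverseʳ (⊖ s))) ⟩
  ((⊖ s) ⊕ (⊖ (⊖ s))) ⊕ z            ≡⟨ cong (λ t → ((⊖ s) ⊕ t) ⊕ z) (⊖-involutive s) ⟩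
  ((⊖ s) ⊕ s) ⊕ z                    ≡⟨ ⊕-assoc (⊖ s) s z ⟩
  (⊖ s) ⊕ (s ⊕ z)                    ≡⟨ cong ((⊖ s) ⊕_) sum≡𝟘 ⟩
  (⊖ s) ⊕ 𝟘                          ≡⟨ ⊕-comm (⊖ s) 𝟘 ⟩
  𝟘 ⊕ (⊖ s)                          ≡⟨ ⊕-identityˡ (⊖ s) ⟩
  ⊖ s                                ∎
  where
  open ≡-Reasoning
  s = x ⊕ y

self-third-point : ∀ {n} (x y : Vec F3 n) →
  x ≡ Vec.map -₃_ (zipWith _+₃_ x y) → y ≡ x
self-third-point [] [] _ = refl
self-third-point (a ∷ x) (b ∷ y) e =
  cong₂ _∷_ (self-third a b (Vecₚ.∷-injectiveˡ e)) (self-third-point x y (Vecₚ.∷-injectiveʳ e))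

scale : F3 → Point → Point
scale k = Vec.map (k *₃_)

scale-distribʳ : ∀ {n} k l (v : Vec F3 n) →
  Vec.map ((k +₃ l) *₃_) v ≡ zipWith _+₃_ (Vec.map (k *₃_) v) (Vec.map (l *₃_) v)
scale-distribʳ k l [] = refl
scale-distribʳ k l (a ∷ v) = cong₂ _∷_ (*₃-distribʳ k l a) (scale-distribʳ k l v)

scale-negˡ : ∀ {n} k (v : Vec F3 n) → Vec.map ((-₃ k) *₃_) v ≡ Vec.map -₃_ (Vec.map (k *₃_) v)
scale-negˡ k [] = refl
scale-negˡ k (a ∷ v) = cong₂ _∷_ (*₃-negˡ k a) (scale-negˡ k v)

-- A matrix is the list of its columns; M · a = Σᵢ aᵢ cᵢ.
Mat : Set
Mat = Vec Point 4

infix 20 _·_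
_·_ : ∀ {m} → Vec Point (suc m) → Vec F3 (suc m) → Point
(c ∷ []) · (a ∷ []) = scale a c
(c ∷ cs@(_ ∷ _)) · (a ∷ as) = scale a c ⊕ (cs · as)

·-⊕ : ∀ {m} (M : Vec Point (suc m)) x y → M · zipWith _+₃_ x y ≡ (M · x) ⊕ (M · y)
·-⊕ (c ∷ []) (a ∷ []) (b ∷ []) = scale-distribʳ a b c
·-⊕ (c ∷ cs@(_ ∷ _)) (a ∷ x) (b ∷ y) = begin
  scale (a +₃ b) c ⊕ (cs · zipWith _+₃_ x y)     ≡⟨ cong₂ _⊕_ (scale-distribʳ a b c) (·-⊕ cs x y) ⟩
  (scale a c ⊕ scale b c) ⊕ ((cs · x) ⊕ (cs · y)) ≡⟨ ⊕-interchange _ _ _ _ ⟩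
  (scale a c ⊕ (cs · x)) ⊕ (scale b c ⊕ (cs · y)) ∎
  where open ≡-Reasoning

·-⊖ : ∀ {m} (M : Vec Point (suc m)) x → M · Vec.map -₃_ x ≡ ⊖ (M · x)
·-⊖ (c ∷ []) (a ∷ []) = scale-negˡ a c
·-⊖ (c ∷ cs@(_ ∷ _)) (a ∷ x) = begin
  scale (-₃ a) c ⊕ (cs · Vec.map -₃_ x)   ≡⟨ cong₂ _⊕_ (scale-negˡ a c) (·-⊖ cs x) ⟩
  (⊖ scale a c) ⊕ (⊖ (cs · x))            ≡⟨ sym (⊖-distrib (scale a c) (cs · x)) ⟩
  ⊖ (scale a c ⊕ (cs · x))                ∎
  where open ≡-Reasoning

-- Boolean reflection.  All finite facts below are established by evaluating
-- Boolean checks; these lemmas turn a successful check into a proof.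

true≢false : true ≢ false
true≢false ()

∧-elimˡ : ∀ a {b} → a ∧ b ≡ true → a ≡ true
∧-elimˡ true _ = refl

∧-elimʳ : ∀ a {b} → a ∧ b ≡ true → b ≡ true
∧-elimʳ true p = p

∨-resolve : ∀ a {b} → a ∨ b ≡ true → a ≡ false → b ≡ true
∨-resolve false p _ = p

∨-false : ∀ a {b} → a ∨ b ≡ false → a ≡ false × b ≡ false
∨-false false p = refl , p

T⇒true : ∀ {b} → T b → b ≡ true
T⇒true {true} _ = refl

not-true : ∀ {a} → not a ≡ true → a ≡ false
not-true {false} _ = refl

not-false : ∀ {a} → not a ≡ false → a ≡ true
not-false {true} _ = refl

¬true⇒false : ∀ {b} → ¬ (b ≡ true) → b ≡ false
¬true⇒false {true} h = ⊥-elim (h refl)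
¬true⇒false {false} h = refl

bool-ext : ∀ {a b : Bool} → (a ≡ true → b ≡ true) → (b ≡ true → a ≡ true) → a ≡ b
bool-ext {true} to _ = sym (to refl)
bool-ext {false} {true} _ from = from refl
bool-ext {false} {false} _ _ = refl

_==_ : ∀ {n} → Fin n → Fin n → Bool
zero == zero = true
suc a == suc b = a == b
_ == _ = false

==-sound : ∀ {n} (a b : Fin n) → a == b ≡ true → a ≡ b
==-sound zero zero _ = refl
==-sound (suc a) (suc b) e = cong suc (==-sound a b e)

==-refl : ∀ {n} (a : Fin n) → a == a ≡ true
==-refl zero = refl
==-refl (suc a) = ==-refl a

eqP : ∀ {n} → Vec F3 n → Vec F3 n → Bool
eqP [] [] = true
eqP (a ∷ x) (b ∷ y) = (a == b) ∧ eqP x y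

eqP-sound : ∀ {n} (x y : Vec F3 n) → eqP x y ≡ true → x ≡ y
eqP-sound [] [] _ = refl
eqP-sound (a ∷ x) (b ∷ y) e =
  cong₂ _∷_ (==-sound a b (∧-elimˡ (a == b) e)) (eqP-sound x y (∧-elimʳ (a == b) e))

eqP-refl : ∀ {n} (x : Vec F3 n) → eqP x x ≡ true
eqP-refl [] = refl
eqP-refl (a ∷ x) rewrite ==-refl a = eqP-refl x

eqP-false : ∀ {n} (x y : Vec F3 n) → eqP x y ≡ false → x ≢ y
eqP-false x .x e refl = true≢false (trans (sym (eqP-refl x)) e)

eqP-complete : ∀ {n} (x y : Vec F3 n) → x ≢ y → eqP x y ≡ false
eqP-complete x y x≢y = ¬true⇒false (λ e → x≢y (eqP-sound x y e))

all-sound : ∀ {A : Set} (p : A → Bool) (xs : List A) → all p xs ≡ true →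
  ∀ {x} → x ∈ xs → p x ≡ true
all-sound p (y ∷ ys) h (here refl) = ∧-elimˡ _ h
all-sound p (y ∷ ys) h (there m) = all-sound p ys (∧-elimʳ (p y) h) m

all-complete : ∀ {A : Set} (p : A → Bool) (xs : List A) →
  (∀ x → x ∈ xs → p x ≡ true) → all p xs ≡ true
all-complete p [] h = refl
all-complete p (x ∷ xs) h rewrite h x (here refl) = all-complete p xs (λ y m → h y (there m))

all⇒All : ∀ {A : Set} (p : A → Bool) (xs : List A) → all p xs ≡ true → All (λ x → p x ≡ true) xs
all⇒All p xs h = All.tabulate (all-sound p xs h)

any-sound : ∀ {A : Set} (p : A → Bool) (xs : List A) → any p xs ≡ true →
  ∃ λ x → x ∈ xs × p x ≡ true
any-sound p (y ∷ ys) h with p y in py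
... | true = y , here refl , py
... | false = let (z , m , q) = any-sound p ys h in z , there m , q

any-false : ∀ {A : Set} (p : A → Bool) (xs : List A) → any p xs ≡ false →
  ∀ {x} → x ∈ xs → p x ≡ false
any-false p (y ∷ ys) h (here refl) = proj₁ (∨-false (p y) h)
any-false p (y ∷ ys) h (there m) = any-false p ys (proj₂ (∨-false (p y) h)) m

allVecs-complete : ∀ n (x : Vec F3 n) → x ∈ allVecs n
allVecs-complete zero [] = here refl
allVecs-complete (suc n) (a ∷ v) =
  ∈ₚ.∈-concatMap⁺ (λ a' → List.map (a' ∷_) (allVecs n))
    (Any.map (λ { refl → ∈ₚ.∈-map⁺ (a ∷_) (allVecs-complete n v) }) (∈ₚ.∈-allFin a))

allPoints-complete : ∀ x → x ∈ allPoints
allPoints-complete = allVecs-complete 4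

allP : (Point → Bool) → Bool
allP p = all p allPoints

allP-sound : ∀ p → allP p ≡ true → ∀ x → p x ≡ true
allP-sound p h x = all-sound p allPoints h (allPoints-complete x)

allP-complete : ∀ p → (∀ x → p x ≡ true) → allP p ≡ true
allP-complete p h = all-complete p allPoints (λ x _ → h x)

any-split : ∀ {A : Set} {P : A → Set} (ys : List A) → Any P ys →
  Σ (List A) λ us → Σ A λ y → Σ (List A) λ vs → ys ≡ us ++ y ∷ vs × P y
any-split (y ∷ ys) (here p) = [] , y , ys , refl , p
any-split (y ∷ ys) (there a) with any-split ys a
... | us , z , vs , refl , p = y ∷ us , z , vs , refl , p

any-remove : ∀ {A : Set} {P : A → Set} (us : List A) {y : A} {vs : List A} →
  Any P (us ++ y ∷ vs) → ¬ P y → Any P (us ++ vs)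
any-remove [] (here p) ¬p = ⊥-elim (¬p p)
any-remove [] (there a) ¬p = a
any-remove (u ∷ us) (here p) ¬p = here p
any-remove (u ∷ us) (there a) ¬p = there (any-remove us a ¬p)

length-middle : ∀ {A : Set} (us : List A) (y : A) (vs : List A) →
  length (us ++ y ∷ vs) ≡ suc (length (us ++ vs))
length-middle [] y vs = refl
length-middle (u ∷ us) y vs = cong suc (length-middle us y vs)

module Pigeonhole {A : Set} (R : A → A → Set)
  (R-sym : ∀ {x y} → R x y → R y x) (R-trans : ∀ {x y z} → R x y → R y z → R x z) where

  pigeonhole : (xs ys : List A) → AllPairs (λ a b → ¬ R a b) xs →
    All (λ x → Any (R x) ys) xs → length xs ≤ length ys
  pigeonhole [] ys _ _ = z≤n
  pigeonhole (x ∷ xs) ys (x≁xs ∷ distinct) (x∼y ∷ covered) with any-split ys x∼y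
  ... | us , y , vs , refl , rxy =
    subst (suc (length xs) ≤_) (sym (length-middle us y vs))
      (s≤s (pigeonhole xs (us ++ vs) distinct (drop-y xs x≁xs covered)))
    where
    -- y is matched by x, so no other element of xs can be matched by y.
    drop-y : ∀ zs → All (λ z → ¬ R x z) zs → All (λ z → Any (R z) (us ++ y ∷ vs)) zs →
      All (λ z → Any (R z) (us ++ vs)) zs
    drop-y [] [] [] = []
    drop-y (z ∷ zs) (x≁z ∷ ns) (a ∷ as) =
      any-remove us a (λ rzy → x≁z (R-trans rxy (R-sym rzy))) ∷ drop-y zs ns as

_≟P_ : (x y : Point) → Dec (x ≡ y)
_≟P_ = Vecₚ.≡-dec Finₚ._≟_

allPoints-unique : Unique allPoints
allPoints-unique = from-yes (UniqueDec.unique? _≟P_ allPoints)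

members : PSet → List Point
members S = filter (λ x → S x ≟𝔹 true) allPoints

size-≤-list : ∀ S (xs : List Point) → (∀ x → S x ≡ true → x ∈ xs) → size S ≤ length xs
size-≤-list S xs h =
  Pigeonhole.pigeonhole _≡_ sym trans (members S) xs
    (Uniqueₚ.filter⁺ (λ x → S x ≟𝔹 true) allPoints-unique)
    (All.tabulate λ {x} m → h x (proj₂ (∈ₚ.∈-filter⁻ (λ x → S x ≟𝔹 true) {xs = allPoints} m)))

size-≤-image : ∀ T U (φ : Point → Point) →
  (∀ x → x ∈ₛ T → ∃ λ y → y ∈ₛ U × φ y ≡ x) → size T ≤ size U
size-≤-image T U φ onto =
  subst (size T ≤_) (Listₚ.length-map φ (members U))
    (size-≤-list T (List.map φ (members U)) λ x x∈T →
      let (y , y∈U , φy≡x) = onto x x∈T in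
      subst (_∈ List.map φ (members U)) φy≡x
        (∈ₚ.∈-map⁺ φ (∈ₚ.∈-filter⁺ (λ x → U x ≟𝔹 true) (allPoints-complete y) y∈U)))

size-cong : ∀ {S T} → S ≐ T → size S ≡ size T
size-cong {S} {T} S≐T = cong length (filter-cong allPoints)
  where
  filter-cong : ∀ xs → filter (λ x → S x ≟𝔹 true) xs ≡ filter (λ x → T x ≟𝔹 true) xs
  filter-cong [] = refl
  filter-cong (x ∷ xs) with S x | T x | S≐T x
  ... | true | true | refl = cong (x ∷_) (filter-cong xs)
  ... | false | false | refl = filter-cong xs

some-member : ∀ S → 0 < size S → ∃ λ x → x ∈ₛ S
some-member S positive = first (members S) refl
  where
  first : ∀ xs → members S ≡ xs → ∃ λ x → x ∈ₛ S
  first [] eq = ⊥-elim (ℕₚ.n≮0 (subst (0 <_) (cong length eq) positive))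
  first (x ∷ _) eq =
    x , proj₂ (∈ₚ.∈-filter⁻ (λ x → S x ≟𝔹 true) {xs = allPoints} (subst (x ∈_) (sym eq) (here refl)))

≐-sym : ∀ {S T} → S ≐ T → T ≐ S
≐-sym e x = sym (e x)

≐-trans : ∀ {S T U} → S ≐ T → T ≐ U → S ≐ U
≐-trans e e' x = trans (e x) (e' x)

Covers : PSet → PSet → PSet → PSet → Set
Covers A B C D = ∀ x → x ≡ 𝟘 ⊎ x ∈ₛ A ⊎ x ∈ₛ B ⊎ x ∈ₛ C ⊎ x ∈ₛ D

cap-≐ : ∀ {S T} → S ≐ T → IsCap S → IsCap T
cap-≐ e cap x y z sx sy sz = cap x y z (trans (e x) sx) (trans (e y) sy) (trans (e z) sz)

maxCap0-≐ : ∀ {S T} → S ≐ T → MaxCap0 S → MaxCap0 T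
maxCap0-≐ {S} {T} e ((cap , max) , 𝟘∉S , closed) =
  (cap-≐ e cap , λ U capU → subst (size U ≤_) (size-cong e) (max U capU)) ,
  (λ 𝟘∈T → 𝟘∉S (trans (e 𝟘) 𝟘∈T)) ,
  (λ x x∈T → trans (sym (e _)) (closed x (trans (e x) x∈T)))

disjoint-≐ : ∀ {S T S' T'} → S ≐ S' → T ≐ T' → Disjoint S T → Disjoint S' T'
disjoint-≐ e e' d x (s , t) = d x (trans (e x) s , trans (e' x) t)

covers-≐ : ∀ {A B C D A' B' C' D'} → A ≐ A' → B ≐ B' → C ≐ C' → D ≐ D' →
  Covers A B C D → Covers A' B' C' D'
covers-≐ ea eb ec ed cv x with cv x
... | inj₁ p = inj₁ p
... | inj₂ (inj₁ p) = inj₂ (inj₁ (trans (sym (ea x)) p))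
... | inj₂ (inj₂ (inj₁ p)) = inj₂ (inj₂ (inj₁ (trans (sym (eb x)) p)))
... | inj₂ (inj₂ (inj₂ (inj₁ p))) = inj₂ (inj₂ (inj₂ (inj₁ (trans (sym (ec x)) p))))
... | inj₂ (inj₂ (inj₂ (inj₂ p))) = inj₂ (inj₂ (inj₂ (inj₂ (trans (sym (ed x)) p))))

partition-≐ : ∀ {A B C D A' B' C' D'} → A ≐ A' → B ≐ B' → C ≐ C' → D ≐ D' →
  IsPartition0 A B C D → IsPartition0 A' B' C' D'
partition-≐ ea eb ec ed (ma , mb , mc , md , dab , dac , dad , dbc , dbd , dcd , cv) =
  maxCap0-≐ ea ma , maxCap0-≐ eb mb , maxCap0-≐ ec mc , maxCap0-≐ ed md ,
  disjoint-≐ ea eb dab , disjoint-≐ ea ec dac , disjoint-≐ ea ed dad ,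
  disjoint-≐ eb ec dbc , disjoint-≐ eb ed dbd , disjoint-≐ ec ed dcd , covers-≐ ea eb ec ed cv

samePair-sym : ∀ {p q} → SamePair p q → SamePair q p
samePair-sym {_ , _} {_ , _} (inj₁ (a , b)) = inj₁ (≐-sym a , ≐-sym b)
samePair-sym {_ , _} {_ , _} (inj₂ (a , b)) = inj₂ (≐-sym b , ≐-sym a)

samePair-trans : ∀ {p q r} → SamePair p q → SamePair q r → SamePair p r
samePair-trans {_ , _} {_ , _} {_ , _} (inj₁ (a , b)) (inj₁ (c , d)) = inj₁ (≐-trans a c , ≐-trans b d)
samePair-trans {_ , _} {_ , _} {_ , _} (inj₁ (a , b)) (inj₂ (c , d)) = inj₂ (≐-trans a c , ≐-trans b d)
samePair-trans {_ , _} {_ , _} {_ , _} (inj₂ (a , b)) (inj₁ (c , d)) = inj₂ (≐-trans a d , ≐-trans b c)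
samePair-trans {_ , _} {_ , _} {_ , _} (inj₂ (a , b)) (inj₂ (c , d)) = inj₁ (≐-trans a d , ≐-trans b c)

completable-≐ : ∀ {k X Y X' Y'} → X ≐ X' → Y ≐ Y' → Completable k X Y → Completable k X' Y'
completable-≐ ex ey (Ls , len , complete , distinct , every) =
  Ls , len ,
  All.map (λ {p} → partition-≐ ex ey (λ _ → refl) (λ _ → refl)) complete ,
  distinct ,
  λ C D part → every C D (partition-≐ (≐-sym ex) (≐-sym ey) (λ _ → refl) (λ _ → refl) part)

disjoint-sym : ∀ {S T} → Disjoint S T → Disjoint T S
disjoint-sym d x (s , t) = d x (t , s)

covers-swap₁₂ : ∀ {A B C D} → Covers A B C D → Covers B A C D
covers-swap₁₂ cv x with cv x
... | inj₁ p = inj₁ p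
... | inj₂ (inj₁ p) = inj₂ (inj₂ (inj₁ p))
... | inj₂ (inj₂ (inj₁ p)) = inj₂ (inj₁ p)
... | inj₂ (inj₂ (inj₂ q)) = inj₂ (inj₂ (inj₂ q))

covers-swapPairs : ∀ {A B C D} → Covers A B C D → Covers C D A B
covers-swapPairs cv x with cv x
... | inj₁ p = inj₁ p
... | inj₂ (inj₁ p) = inj₂ (inj₂ (inj₂ (inj₁ p)))
... | inj₂ (inj₂ (inj₁ p)) = inj₂ (inj₂ (inj₂ (inj₂ p)))
... | inj₂ (inj₂ (inj₂ (inj₁ p))) = inj₂ (inj₁ p)
... | inj₂ (inj₂ (inj₂ (inj₂ p))) = inj₂ (inj₂ (inj₁ p))

partition-swap₁₂ : ∀ {A B C D} → IsPartition0 A B C D → IsPartition0 B A C D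
partition-swap₁₂ (ma , mb , mc , md , dab , dac , dad , dbc , dbd , dcd , cv) =
  mb , ma , mc , md , disjoint-sym dab , dbc , dbd , dac , dad , dcd , covers-swap₁₂ cv

partition-swapPairs : ∀ {A B C D} → IsPartition0 A B C D → IsPartition0 C D A B
partition-swapPairs (ma , mb , mc , md , dab , dac , dad , dbc , dbd , dcd , cv) =
  mc , md , ma , mb , dcd , disjoint-sym dac , disjoint-sym dbc ,
  disjoint-sym dad , disjoint-sym dbd , dab , covers-swapPairs cv

completable-swap : ∀ {k X Y} → Completable k X Y → Completable k Y X
completable-swap (Ls , len , complete , distinct , every) =
  Ls , len , All.map (λ {p} → partition-swap₁₂) complete , distinct ,
  λ C D part → every C D (partition-swap₁₂ part)

completable-samePair : ∀ {k X Y P Q} → SamePair (X , Y) (P , Q) → Completable k P Q → Completable k X Y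
completable-samePair (inj₁ (a , b)) c = completable-≐ (≐-sym a) (≐-sym b) c
completable-samePair (inj₂ (a , b)) c = completable-≐ (≐-sym a) (≐-sym b) (completable-swap c)

-- The number of partitions containing X and Y is well defined: two
-- witnesses of completability have the same length, by pigeonhole both ways.
completable-unique : ∀ {j k X Y} → Completable j X Y → Completable k X Y → j ≡ k
completable-unique {X = X} {Y} (Ls , refl , complete , distinct , every) (Ms , refl , complete' , distinct' , every') =
  ℕₚ.≤-antisym (bound Ls Ms distinct every' complete) (bound Ms Ls distinct' every complete')
  where
  open Pigeonhole SamePair samePair-sym samePair-trans
  bound : ∀ Ls Ms → AllPairs (λ p q → ¬ SamePair p q) Ls →
    (∀ C D → IsPartition0 X Y C D → Any (SamePair (C , D)) Ms) →
    All (Completes X Y) Ls → length Ls ≤ length Ms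
  bound Ls Ms distinct every complete =
    pigeonhole Ls Ms distinct (All.map (λ { {C , D} → every C D }) complete)

-- They fix the anchor 𝟘 and map lines to
-- lines, so taking preimages preserves caps, anchors, sizes, partitions and
-- completion counts.

record LinAut : Set where
  field
    to from : Point → Point
    from∘to : ∀ x → from (to x) ≡ x
    to∘from : ∀ x → to (from x) ≡ x
    to-⊕ : ∀ x y → to (x ⊕ y) ≡ to x ⊕ to y
    to-⊖ : ∀ x → to (⊖ x) ≡ ⊖ (to x)

  to-𝟘 : to 𝟘 ≡ 𝟘
  to-𝟘 = begin
    to 𝟘                ≡⟨ cong to (sym (⊕-inverseʳ 𝟘)) ⟩
    to (𝟘 ⊕ (⊖ 𝟘))      ≡⟨ to-⊕ 𝟘 (⊖ 𝟘) ⟩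
    to 𝟘 ⊕ to (⊖ 𝟘)     ≡⟨ cong (to 𝟘 ⊕_) (to-⊖ 𝟘) ⟩
    to 𝟘 ⊕ (⊖ (to 𝟘))   ≡⟨ ⊕-inverseʳ (to 𝟘) ⟩
    𝟘                   ∎
    where open ≡-Reasoning

  to-injective : ∀ {x y} → to x ≡ to y → x ≡ y
  to-injective {x} {y} e = trans (sym (from∘to x)) (trans (cong from e) (from∘to y))

inverse : LinAut → LinAut
inverse h = record
  { to = from ; from = to ; from∘to = to∘from ; to∘from = from∘to
  ; to-⊕ = from-⊕ ; to-⊖ = from-⊖ }
  where
  open LinAut h
  open ≡-Reasoning
  from-⊕ : ∀ x y → from (x ⊕ y) ≡ from x ⊕ from y
  from-⊕ x y = begin
    from (x ⊕ y)                    ≡⟨ cong from (cong₂ _⊕_ (sym (to∘from x)) (sym (to∘from y))) ⟩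
    from (to (from x) ⊕ to (from y)) ≡⟨ cong from (sym (to-⊕ (from x) (from y))) ⟩
    from (to (from x ⊕ from y))     ≡⟨ from∘to _ ⟩
    from x ⊕ from y                 ∎
  from-⊖ : ∀ x → from (⊖ x) ≡ ⊖ (from x)
  from-⊖ x = begin
    from (⊖ x)              ≡⟨ cong (λ t → from (⊖ t)) (sym (to∘from x)) ⟩
    from (⊖ (to (from x)))  ≡⟨ cong from (sym (to-⊖ (from x))) ⟩
    from (to (⊖ (from x)))  ≡⟨ from∘to _ ⟩
    ⊖ (from x)              ∎

invertibleᵇ : Mat → Mat → Bool
invertibleᵇ M N = allP (λ x → eqP (N · (M · x)) x ∧ eqP (M · (N · x)) x)

matrixAut : (M N : Mat) → invertibleᵇ M N ≡ true → LinAut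
matrixAut M N inv = record
  { to = M ·_ ; from = N ·_
  ; from∘to = λ x → eqP-sound _ _ (∧-elimˡ _ (inverse-at x))
  ; to∘from = λ x → eqP-sound _ _ (∧-elimʳ (eqP (N · (M · x)) x) (inverse-at x))
  ; to-⊕ = ·-⊕ M ; to-⊖ = ·-⊖ M }
  where
  inverse-at = allP-sound (λ x → eqP (N · (M · x)) x ∧ eqP (M · (N · x)) x) inv

infix 25 _⁻¹[_]
_⁻¹[_] : LinAut → PSet → PSet
(h ⁻¹[ S ]) x = S (LinAut.to h x)

module Preimage (h : LinAut) where
  open LinAut h

  cap-preimage : ∀ {S} → IsCap S → IsCap (h ⁻¹[ S ])
  cap-preimage cap x y z sx sy sz (x≢y , y≢z , x≢z , line) =
    cap (to x) (to y) (to z) sx sy sz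
      ( (λ e → x≢y (to-injective e)) , (λ e → y≢z (to-injective e)) , (λ e → x≢z (to-injective e))
      , (begin
          (to x ⊕ to y) ⊕ to z  ≡⟨ cong (_⊕ to z) (sym (to-⊕ x y)) ⟩
          to (x ⊕ y) ⊕ to z     ≡⟨ sym (to-⊕ (x ⊕ y) z) ⟩
          to ((x ⊕ y) ⊕ z)      ≡⟨ cong to line ⟩
          to 𝟘                  ≡⟨ to-𝟘 ⟩
          𝟘                     ∎))
    where open ≡-Reasoning

  anchor-preimage : ∀ {S} → HasAnchor 𝟘 S → HasAnchor 𝟘 (h ⁻¹[ S ])
  anchor-preimage {S} (𝟘∉S , closed) =
    (λ 𝟘∈ → 𝟘∉S (subst (_∈ₛ S) to-𝟘 𝟘∈)) ,
    (λ x x∈ → subst (_∈ₛ S) (sym (to-partner x)) (closed (to x) x∈))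
    where
    to-partner : ∀ x → to (⊖ (𝟘 ⊕ x)) ≡ ⊖ (𝟘 ⊕ to x)
    to-partner x = trans (to-⊖ (𝟘 ⊕ x)) (cong ⊖_ (trans (to-⊕ 𝟘 x) (cong (_⊕ to x) to-𝟘)))

  size-preimage : ∀ S → size (h ⁻¹[ S ]) ≡ size S
  size-preimage S = ℕₚ.≤-antisym
    (size-≤-image (h ⁻¹[ S ]) S from (λ x x∈ → to x , x∈ , from∘to x))
    (size-≤-image S (h ⁻¹[ S ]) to
      (λ x x∈ → from x , subst (_∈ₛ S) (sym (to∘from x)) x∈ , to∘from x))

  maxCap0-preimage : ∀ {S} → MaxCap0 S → MaxCap0 (h ⁻¹[ S ])
  maxCap0-preimage {S} ((cap , max) , anchor) =
    (cap-preimage cap , λ U capU → subst (size U ≤_) (sym (size-preimage S)) (max U capU)) ,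
    anchor-preimage anchor

  covers-preimage : ∀ {A B C D} → Covers A B C D →
    Covers (h ⁻¹[ A ]) (h ⁻¹[ B ]) (h ⁻¹[ C ]) (h ⁻¹[ D ])
  covers-preimage cv x with cv (to x)
  ... | inj₁ to-x≡𝟘 = inj₁ (to-injective (trans to-x≡𝟘 (sym to-𝟘)))
  ... | inj₂ in-some-cap = inj₂ in-some-cap

  partition-preimage : ∀ {A B C D} → IsPartition0 A B C D →
    IsPartition0 (h ⁻¹[ A ]) (h ⁻¹[ B ]) (h ⁻¹[ C ]) (h ⁻¹[ D ])
  partition-preimage (ma , mb , mc , md , dab , dac , dad , dbc , dbd , dcd , cv) =
    maxCap0-preimage ma , maxCap0-preimage mb , maxCap0-preimage mc , maxCap0-preimage md ,
    (λ x → dab (to x)) , (λ x → dac (to x)) , (λ x → dad (to x)) ,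
    (λ x → dbc (to x)) , (λ x → dbd (to x)) , (λ x → dcd (to x)) , covers-preimage cv

  preimage-inverse : ∀ S → inverse h ⁻¹[ h ⁻¹[ S ] ] ≐ S
  preimage-inverse S x = cong S (to∘from x)

  preimage-injective : ∀ {S T} → h ⁻¹[ S ] ≐ h ⁻¹[ T ] → S ≐ T
  preimage-injective {S} {T} e x = trans (cong S (sym (to∘from x))) (trans (e (from x)) (cong T (to∘from x)))

  preimage-adjoint : ∀ {S T} → inverse h ⁻¹[ S ] ≐ T → S ≐ h ⁻¹[ T ]
  preimage-adjoint {S} e x = trans (cong S (sym (from∘to x))) (e (to x))

  -- SamePair is reflected by preimages, which is what keeps completions distinct.
  preimage² : PSet × PSet → PSet × PSet
  preimage² (C , D) = h ⁻¹[ C ] , h ⁻¹[ D ]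

  samePair-preimage⁻ : ∀ p q → SamePair (preimage² p) (preimage² q) → SamePair p q
  samePair-preimage⁻ (_ , _) (_ , _) (inj₁ (a , b)) = inj₁ (preimage-injective a , preimage-injective b)
  samePair-preimage⁻ (_ , _) (_ , _) (inj₂ (a , b)) = inj₂ (preimage-injective a , preimage-injective b)

  samePair-adjoint : ∀ C D p → SamePair (inverse h ⁻¹[ C ] , inverse h ⁻¹[ D ]) p →
    SamePair (C , D) (preimage² p)
  samePair-adjoint C D (_ , _) (inj₁ (a , b)) = inj₁ (preimage-adjoint a , preimage-adjoint b)
  samePair-adjoint C D (_ , _) (inj₂ (a , b)) = inj₂ (preimage-adjoint a , preimage-adjoint b)

completable-preimage : ∀ h {k X Y} → Completable k X Y → Completable k (h ⁻¹[ X ]) (h ⁻¹[ Y ])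
completable-preimage h {X = X} {Y} (Ls , len , complete , distinct , every) =
  List.map preimage² Ls ,
  trans (Listₚ.length-map preimage² Ls) len ,
  Allₚ.map⁺ (All.map (λ { {_ , _} → partition-preimage }) complete) ,
  AllPairsₚ.map⁺ (AllPairs.map (λ {p} {q} p≁q same → p≁q (samePair-preimage⁻ p q same)) distinct) ,
  λ C D part → Anyₚ.map⁺ (Any.map (λ {p} → samePair-adjoint C D p) (every _ _ (back part)))
  where
  open Preimage h
  back : ∀ {C D} → IsPartition0 (h ⁻¹[ X ]) (h ⁻¹[ Y ]) C D →
    IsPartition0 X Y (inverse h ⁻¹[ C ]) (inverse h ⁻¹[ D ])
  back part = partition-≐ (preimage-inverse X) (preimage-inverse Y) (λ _ → refl) (λ _ → refl)
    (Preimage.partition-preimage (inverse h) part)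

completable-preimage⁻ : ∀ h {k X Y} → Completable k (h ⁻¹[ X ]) (h ⁻¹[ Y ]) → Completable k X Y
completable-preimage⁻ h {X = X} {Y} c =
  completable-≐ (Preimage.preimage-inverse h X) (Preimage.preimage-inverse h Y)
    (completable-preimage (inverse h) c)

CountTransfer : PSet → PSet → PSet → PSet → Set
CountTransfer A B C D = IsPartition0 A B C D → ∀ k → Completable k A B → Completable k C D

transfer-preimage : ∀ h {A B C D} →
  CountTransfer (h ⁻¹[ A ]) (h ⁻¹[ B ]) (h ⁻¹[ C ]) (h ⁻¹[ D ]) → CountTransfer A B C D
transfer-preimage h H part k c =
  completable-preimage⁻ h (H (Preimage.partition-preimage h part) k (completable-preimage h c))

transfer-≐ : ∀ {A B C D A' B' C' D'} → A ≐ A' → B ≐ B' → C ≐ C' → D ≐ D' →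
  CountTransfer A' B' C' D' → CountTransfer A B C D
transfer-≐ ea eb ec ed H part k c =
  completable-≐ (≐-sym ec) (≐-sym ed) (H (partition-≐ ea eb ec ed part) k (completable-≐ ea eb c))

digit : ℕ → F3
digit 0 = zero
digit 1 = suc zero
digit _ = suc (suc zero)

decode : ℕ → Point
decode a = digit (a % 3) ∷ digit ((a / 3) % 3) ∷ digit ((a / 9) % 3) ∷ digit ((a / 27) % 3) ∷ []

encode : Point → ℕ
encode (a ∷ b ∷ c ∷ d ∷ []) = toℕ a + 3 * toℕ b + 9 * toℕ c + 27 * toℕ d

decode-encode : ∀ x → decode (encode x) ≡ x
decode-encode x = eqP-sound _ _ (allP-sound (λ x → eqP (decode (encode x)) x) refl x)

thirdCode : ℕ → ℕ → ℕ
thirdCode a b = encode (⊖ (decode a ⊕ decode b))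

negCode : ℕ → ℕ
negCode a = encode (⊖ (decode a))

elemᵇ : ℕ → List ℕ → Bool
elemᵇ x [] = false
elemᵇ x (y ∷ ys) = (x ≡ᵇ y) ∨ elemᵇ x ys

elemᵇ-sound : ∀ x ys → elemᵇ x ys ≡ true → x ∈ ys
elemᵇ-sound x (y ∷ ys) h with x ≡ᵇ y in eq
... | true = here (ℕₚ.≡ᵇ⇒≡ x y (subst T (sym eq) _))
... | false = there (elemᵇ-sound x ys h)

elemᵇ-complete : ∀ x ys → x ∈ ys → elemᵇ x ys ≡ true
elemᵇ-complete x (y ∷ ys) (here refl) rewrite T⇒true (ℕₚ.≡⇒≡ᵇ x x refl) = refl
elemᵇ-complete x (y ∷ ys) (there m) rewrite elemᵇ-complete x ys m = Boolₚ.∨-zeroʳ (x ≡ᵇ y)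

-- A cap S with anchor 𝟘 is closed under x ↦ −x, so
-- it is described by one code per pair {x, −x}.  The search keeps chosen
-- codes (in S), forbidden codes (provably not in S) and remaining candidates;
-- choosing p forbids the third points of all lines through p and ±c for
-- chosen c.  Branches that cannot reach 10 pairs are pruned.

unforbidden : List ℕ → List ℕ → List ℕ
unforbidden forb [] = []
unforbidden forb (r ∷ rs) with elemᵇ r forb
... | true = unforbidden forb rs
... | false = r ∷ unforbidden forb rs

excludedBy : ℕ → List ℕ → List ℕ
excludedBy p [] = []
excludedBy p (c ∷ cs) with eqP (decode p) (decode c) ∨ eqP (decode p) (⊖ (decode c))
... | true = excludedBy p cs
... | false = thirdCode p c ∷ negCode (thirdCode p c) ∷
              thirdCode p (negCode c) ∷ negCode (thirdCode p (negCode c)) ∷ excludedBy p cs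

-- capSearch n chosen forbidden candidates: n more pairs are to be chosen.
-- A leaf (I , E) lists the chosen codes and the candidates never decided.
capSearch : ℕ → List ℕ → List ℕ → List ℕ → List (List ℕ × List ℕ)
capSearch zero chosen forb rem = (chosen , unforbidden forb rem) ∷ []
capSearch (suc n) chosen forb [] = []
capSearch (suc n) chosen forb (p ∷ rem) with elemᵇ p forb
... | true = capSearch (suc n) chosen forb rem
... | false with suc n ≤ᵇ suc (length (unforbidden forb rem))
...   | false = []
...   | true = capSearch n (p ∷ chosen) (excludedBy p chosen ++ forb) rem ++
               capSearch (suc n) chosen (p ∷ forb) rem

commit : List ℕ → List ℕ × List ℕ
commit [] = [] , []
commit (p ∷ ps) with commit ps
... | chosen , forb = p ∷ chosen , excludedBy p chosen ++ forb

CoveredBy : PSet → List ℕ → Set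
CoveredBy S L = ∀ x → x ∈ₛ S → Any (λ a → decode a ≡ x ⊎ decode a ≡ ⊖ x) L

pointsOf : List ℕ → List Point
pointsOf L = List.map decode L ++ List.map (λ a → ⊖ (decode a)) L

-- A set with 20 points cannot be covered by fewer than 10 codes.
too-few-codes : ∀ i n a → i + suc n ≡ 10 → a ≤ n → ¬ (20 ≤ (i + a) + (i + a))
too-few-codes i n a total a≤n big = ℕₚ.1+n≰n (ℕₚ.≤-trans (ℕₚ.n≤1+n _) two+m≤m)
  where
  m = (i + a) + (i + a)
  i+a<10 : suc (i + a) ≤ 10
  i+a<10 = subst (suc (i + a) ≤_) (trans (sym (ℕₚ.+-suc i n)) total) (s≤s (ℕₚ.+-monoʳ-≤ i a≤n))
  two+m≤m : suc (suc m) ≤ m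
  two+m≤m = subst (_≤ m) (ℕₚ.+-suc (suc (i + a)) (i + a))
    (ℕₚ.≤-trans (ℕₚ.+-mono-≤ i+a<10 i+a<10) big)

module CapSearch (S : PSet) (capS : IsCap S) (anchorS : HasAnchor 𝟘 S) where

  inS : ℕ → Bool
  inS a = S (decode a)

  Chosen Forbidden : List ℕ → Set
  Chosen = All (λ a → inS a ≡ true)
  Forbidden = All (λ a → inS a ≡ false)

  S-neg : ∀ x → x ∈ₛ S → (⊖ x) ∈ₛ S
  S-neg x x∈S = subst (_∈ₛ S) (cong ⊖_ (⊕-identityˡ x)) (proj₂ anchorS x x∈S)

  S-neg⁻ : ∀ x → (⊖ x) ∈ₛ S → x ∈ₛ S
  S-neg⁻ x h = subst (_∈ₛ S) (⊖-involutive x) (S-neg (⊖ x) h)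

  inS-encode : ∀ x → inS (encode x) ≡ S x
  inS-encode x = cong S (decode-encode x)

  covering-code-in : ∀ a x → x ∈ₛ S → (decode a ≡ x ⊎ decode a ≡ ⊖ x) → inS a ≡ true
  covering-code-in a x x∈S (inj₁ e) = trans (cong S e) x∈S
  covering-code-in a x x∈S (inj₂ e) = trans (cong S e) (S-neg x x∈S)

  forbidden-out : ∀ p forb → elemᵇ p forb ≡ true → Forbidden forb → inS p ≡ false
  forbidden-out p forb h out = All.lookup out (elemᵇ-sound p forb h)

  cover-drop : ∀ ins p rem → inS p ≡ false → CoveredBy S (ins ++ p ∷ rem) → CoveredBy S (ins ++ rem)
  cover-drop ins p rem p∉S cov x x∈S =
    any-remove ins (cov x x∈S) (λ c → true≢false (trans (sym (covering-code-in p x x∈S c)) p∉S))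

  cover-unforbidden : ∀ ins forb rem → Forbidden forb → CoveredBy S (ins ++ rem) →
    CoveredBy S (ins ++ unforbidden forb rem)
  cover-unforbidden ins forb [] out cov = cov
  cover-unforbidden ins forb (r ∷ rem) out cov with elemᵇ r forb in r-forb
  ... | true = cover-unforbidden ins forb rem out (cover-drop ins r rem (forbidden-out r forb r-forb out) cov)
  ... | false = λ x x∈S → reassoc (cover-unforbidden (ins List.∷ʳ r) forb rem out
                  (λ y y∈S → subst (Any _) (sym (Listₚ.++-assoc ins (r ∷ []) rem)) (cov y y∈S)) x x∈S)
    where
    reassoc : ∀ {P : ℕ → Set} → Any P ((ins List.∷ʳ r) ++ unforbidden forb rem) →
      Any P (ins ++ r ∷ unforbidden forb rem)
    reassoc {P} = subst (Any P) (Listₚ.++-assoc ins (r ∷ []) (unforbidden forb rem))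

  size-≤-cover : ∀ L → CoveredBy S L → size S ≤ length L + length L
  size-≤-cover L cov =
    subst (size S ≤_) length-pointsOf (size-≤-list S (pointsOf L) (λ x x∈S → as-point x (cov x x∈S)))
    where
    length-pointsOf : length (pointsOf L) ≡ length L + length L
    length-pointsOf = trans (Listₚ.length-++ (List.map decode L))
      (cong₂ _+_ (Listₚ.length-map decode L) (Listₚ.length-map _ L))
    as-point : ∀ x → Any (λ a → decode a ≡ x ⊎ decode a ≡ ⊖ x) L → x ∈ pointsOf L
    as-point x c with find c
    ... | a , a∈L , inj₁ e = ∈ₚ.∈-++⁺ˡ (subst (_∈ List.map decode L) e (∈ₚ.∈-map⁺ decode a∈L))
    ... | a , a∈L , inj₂ e = ∈ₚ.∈-++⁺ʳ (List.map decode L)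
          (subst (_∈ List.map (λ a → ⊖ (decode a)) L) (trans (cong ⊖_ e) (⊖-involutive x)) (∈ₚ.∈-map⁺ (λ a → ⊖ (decode a)) a∈L))

  third-out : ∀ P C → P ∈ₛ S → C ∈ₛ S → P ≢ C → S (⊖ (P ⊕ C)) ≡ false
  third-out P C P∈S C∈S P≢C = ¬true⇒false λ Z∈S →
    capS P C (⊖ (P ⊕ C)) P∈S C∈S Z∈S
      ( P≢C
      , (λ e → P≢C (self-third-point C P (trans e (cong ⊖_ (⊕-comm P C)))))
      , (λ e → P≢C (sym (self-third-point P C e)))
      , ⊕-inverseʳ (P ⊕ C))

  neg-out : ∀ a → inS a ≡ false → inS (negCode a) ≡ false
  neg-out a a∉S = ¬true⇒false λ h →
    true≢false (trans (sym (S-neg⁻ (decode a) (trans (sym (inS-encode _)) h))) a∉S)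

  excluded-out : ∀ p chosen → inS p ≡ true → Chosen chosen → Forbidden (excludedBy p chosen)
  excluded-out p [] p∈S [] = []
  excluded-out p (c ∷ cs) p∈S (c∈S ∷ cs∈S)
    with eqP (decode p) (decode c) ∨ eqP (decode p) (⊖ (decode c)) in same
  ... | true = excluded-out p cs p∈S cs∈S
  ... | false = third₁ ∷ neg-out (thirdCode p c) third₁ ∷ third₂ ∷ neg-out (thirdCode p (negCode c)) third₂ ∷ excluded-out p cs p∈S cs∈S
    where
    P = decode p
    C = decode c
    distinct = ∨-false (eqP P C) same
    third₁ : inS (thirdCode p c) ≡ false
    third₁ = trans (inS-encode _) (third-out P C p∈S c∈S (eqP-false P C (proj₁ distinct)))
    third₂ : inS (thirdCode p (negCode c)) ≡ false
    third₂ = trans (inS-encode _)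
      (subst (λ w → S (⊖ (P ⊕ w)) ≡ false) (sym (decode-encode (⊖ C)))
        (third-out P (⊖ C) p∈S (S-neg C c∈S) (eqP-false P (⊖ C) (proj₂ distinct))))

  commit-sound : ∀ ps → Chosen ps → Chosen (proj₁ (commit ps)) × Forbidden (proj₂ (commit ps))
  commit-sound [] [] = [] , []
  commit-sound (p ∷ ps) (p∈S ∷ ps∈S) with commit ps | commit-sound ps ps∈S
  ... | chosen , forb | chosen∈S , forb∉S = (p∈S ∷ chosen∈S) , Allₚ.++⁺ (excluded-out p chosen p∈S chosen∈S) forb∉S

  DescribesS : List ℕ × List ℕ → Set
  DescribesS (I , E) = Chosen I × CoveredBy S (I ++ E)

  search-sound : ∀ n chosen forb rem → Chosen chosen → Forbidden forb →
    CoveredBy S (chosen ++ rem) → length chosen + n ≡ 10 → 20 ≤ size S →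
    Any DescribesS (capSearch n chosen forb rem)
  search-sound zero chosen forb rem chosen∈S forb∉S cov total big = here (chosen∈S , cover-unforbidden chosen forb rem forb∉S cov)
  search-sound (suc n) chosen forb [] chosen∈S forb∉S cov total big =
    ⊥-elim (too-few-codes (length chosen) n 0 total z≤n
      (subst (λ t → 20 ≤ t + t) (sym (ℕₚ.+-identityʳ (length chosen)))
        (ℕₚ.≤-trans big (size-≤-cover chosen (subst (CoveredBy S) (Listₚ.++-identityʳ chosen) cov)))))
  search-sound (suc n) chosen forb (p ∷ rem) chosen∈S forb∉S cov total big with elemᵇ p forb in p-forb
  ... | true = search-sound (suc n) chosen forb rem chosen∈S forb∉S
                 (cover-drop chosen p rem (forbidden-out p forb p-forb forb∉S) cov) total big
  ... | false with suc n ≤ᵇ suc (length (unforbidden forb rem)) in room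
  ...   | false = ⊥-elim (too-few-codes (length chosen) n (suc (length (unforbidden forb rem))) total short
                    (ℕₚ.≤-trans big (subst (λ t → size S ≤ t + t) (Listₚ.length-++ chosen)
                      (size-≤-cover (chosen ++ p ∷ unforbidden forb rem) cov'))))
    where
    cov' : CoveredBy S (chosen ++ p ∷ unforbidden forb rem)
    cov' with cover-unforbidden chosen forb (p ∷ rem) forb∉S cov
    ... | c rewrite p-forb = c
    short : suc (length (unforbidden forb rem)) ≤ n
    short = ℕₚ.≤-pred (ℕₚ.≰⇒> λ h → true≢false (trans (sym (T⇒true (ℕₚ.≤⇒≤ᵇ h))) room))
  ...   | true with inS p in p∈S
  ...     | true = Anyₚ.++⁺ˡ (search-sound n (p ∷ chosen) (excludedBy p chosen ++ forb) rem
                       (p∈S ∷ chosen∈S) (Allₚ.++⁺ (excluded-out p chosen p∈S chosen∈S) forb∉S)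
                       (λ x x∈S → move-p (cov x x∈S)) (trans (sym (ℕₚ.+-suc (length chosen) n)) total) big)
    where
    move-p : ∀ {P : ℕ → Set} → Any P (chosen ++ p ∷ rem) → Any P (p ∷ chosen ++ rem)
    move-p a with Anyₚ.++⁻ chosen a
    ... | inj₁ q = there (Anyₚ.++⁺ˡ q)
    ... | inj₂ (here q) = here q
    ... | inj₂ (there q) = there (Anyₚ.++⁺ʳ chosen q)
  ...     | false = Anyₚ.++⁺ʳ _ (search-sound (suc n) chosen (p ∷ forb) rem chosen∈S (p∈S ∷ forb∉S)
                      (cover-drop chosen p rem p∈S cov) total big)

codeSet : List ℕ → PSet
codeSet F x = elemᵇ (encode x) F

withNegatives : List ℕ → List ℕ
withNegatives I = I ++ List.map negCode I

validCodesᵇ : List ℕ → Bool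
validCodesᵇ I = all (λ a → encode (decode a) ≡ᵇ a) I

validCodes-sound : ∀ I → validCodesᵇ I ≡ true → ∀ {a} → a ∈ I → encode (decode a) ≡ a
validCodes-sound I h {a} a∈I =
  ℕₚ.≡ᵇ⇒≡ _ _ (subst T (sym (all-sound (λ a → encode (decode a) ≡ᵇ a) I h a∈I)) _)

isCapᵇ : List ℕ → Bool
isCapᵇ F = all (λ a → all (λ b → eqP (decode a) (decode b) ∨ not (codeSet F (⊖ (decode a ⊕ decode b)))) F) F

isCapᵇ-sound : ∀ F → isCapᵇ F ≡ true → IsCap (codeSet F)
isCapᵇ-sound F h x y z x∈ y∈ z∈ (x≢y , _ , _ , line) =
  true≢false (trans (sym z∈) z∉)
  where
  check : (eqP (decode (encode x)) (decode (encode y)) ∨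
           not (codeSet F (⊖ (decode (encode x) ⊕ decode (encode y))))) ≡ true
  check = all-sound (λ b → eqP (decode (encode x)) (decode b) ∨ not (codeSet F (⊖ (decode (encode x) ⊕ decode b)))) F
    (all-sound (λ a → all (λ b → eqP (decode a) (decode b) ∨ not (codeSet F (⊖ (decode a ⊕ decode b)))) F) F h
      (elemᵇ-sound (encode x) F x∈))
    (elemᵇ-sound (encode y) F y∈)
  check' : (eqP x y ∨ not (codeSet F (⊖ (x ⊕ y)))) ≡ true
  check' = subst₂ (λ u v → (eqP u v ∨ not (codeSet F (⊖ (u ⊕ v)))) ≡ true)
    (decode-encode x) (decode-encode y) check
  z∉ : codeSet F z ≡ false
  z∉ = subst (λ w → codeSet F w ≡ false) (sym (third-point x y z line))
    (not-true (∨-resolve (eqP x y) check' (eqP-complete x y x≢y)))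

anchoredᵇ : List ℕ → Bool
anchoredᵇ F = not (codeSet F 𝟘) ∧ allP (λ x → not (codeSet F x) ∨ codeSet F (⊖ (𝟘 ⊕ x)))

anchoredᵇ-sound : ∀ F → anchoredᵇ F ≡ true → HasAnchor 𝟘 (codeSet F)
anchoredᵇ-sound F h =
  (λ 𝟘∈ → true≢false (trans (sym 𝟘∈) (not-true (∧-elimˡ _ h)))) ,
  λ x x∈ → ∨-resolve (not (codeSet F x))
    (allP-sound (λ x → not (codeSet F x) ∨ codeSet F (⊖ (𝟘 ⊕ x))) (∧-elimʳ (not (codeSet F 𝟘)) h) x)
    (cong not x∈)

maxCap-bySize : ∀ {M T} → IsMaxCap M → size M ≡ size T → IsCap T → IsMaxCap T
maxCap-bySize (_ , max) e capT = capT , λ U capU → subst (size U ≤_) e (max U capU)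

maxCap0ᵇ : List ℕ → Bool
maxCap0ᵇ F = (size (codeSet F) ≡ᵇ 20) ∧ (isCapᵇ F ∧ anchoredᵇ F)

maxCap0ᵇ-size : ∀ F → maxCap0ᵇ F ≡ true → size (codeSet F) ≡ 20
maxCap0ᵇ-size F h = ℕₚ.≡ᵇ⇒≡ _ _ (subst T (sym (∧-elimˡ _ h)) _)

maxCap0ᵇ-cap : ∀ F → maxCap0ᵇ F ≡ true → IsCap (codeSet F)
maxCap0ᵇ-cap F h = isCapᵇ-sound F (∧-elimˡ _ (∧-elimʳ (size (codeSet F) ≡ᵇ 20) h))

maxCap0ᵇ-sound : ∀ {M} → IsMaxCap M → size M ≡ 20 → ∀ F → maxCap0ᵇ F ≡ true → MaxCap0 (codeSet F)
maxCap0ᵇ-sound maxM size≡20 F h =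
  maxCap-bySize maxM (trans size≡20 (sym (maxCap0ᵇ-size F h))) (maxCap0ᵇ-cap F h) ,
  anchoredᵇ-sound F (∧-elimʳ (isCapᵇ F) (∧-elimʳ (size (codeSet F) ≡ᵇ 20) h))

maxCap-size≥20 : ∀ {S} → IsMaxCap S → ∀ F → maxCap0ᵇ F ≡ true → 20 ≤ size S
maxCap-size≥20 (_ , max) F h = subst (_≤ _) (maxCap0ᵇ-size F h) (max (codeSet F) (maxCap0ᵇ-cap F h))

disjointᵇ : PSet → PSet → Bool
disjointᵇ P Q = allP (λ x → not (P x ∧ Q x))

disjointᵇ-sound : ∀ P Q → disjointᵇ P Q ≡ true → Disjoint P Q
disjointᵇ-sound P Q h x (px , qx) with allP-sound (λ x → not (P x ∧ Q x)) h x
... | c rewrite px | qx = true≢false (sym c)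

coversᵇ : PSet → PSet → PSet → PSet → Bool
coversᵇ A B C D = allP (λ x → eqP x 𝟘 ∨ (A x ∨ (B x ∨ (C x ∨ D x))))

∨-split₅ : ∀ {z a b c d} → (z ∨ (a ∨ (b ∨ (c ∨ d)))) ≡ true →
  z ≡ true ⊎ a ≡ true ⊎ b ≡ true ⊎ c ≡ true ⊎ d ≡ true
∨-split₅ {true} _ = inj₁ refl
∨-split₅ {false} {true} _ = inj₂ (inj₁ refl)
∨-split₅ {false} {false} {true} _ = inj₂ (inj₂ (inj₁ refl))
∨-split₅ {false} {false} {false} {true} _ = inj₂ (inj₂ (inj₂ (inj₁ refl)))
∨-split₅ {false} {false} {false} {false} h = inj₂ (inj₂ (inj₂ (inj₂ h)))

coversᵇ-sound : ∀ A B C D → coversᵇ A B C D ≡ true → Covers A B C D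
coversᵇ-sound A B C D h x with ∨-split₅ (allP-sound (λ x → eqP x 𝟘 ∨ (A x ∨ (B x ∨ (C x ∨ D x)))) h x)
... | inj₁ x≡𝟘 = inj₁ (eqP-sound x 𝟘 x≡𝟘)
... | inj₂ in-some-cap = inj₂ in-some-cap

partitionᵇ : List ℕ → List ℕ → List ℕ → List ℕ → Bool
partitionᵇ FA FB FC FD =
  maxCap0ᵇ FA ∧ (maxCap0ᵇ FB ∧ (maxCap0ᵇ FC ∧ (maxCap0ᵇ FD ∧
  (disjointᵇ A B ∧ (disjointᵇ A C ∧ (disjointᵇ A D ∧ (disjointᵇ B C ∧ (disjointᵇ B D ∧ (disjointᵇ C D ∧
  coversᵇ A B C D)))))))))
  where A = codeSet FA ; B = codeSet FB ; C = codeSet FC ; D = codeSet FD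

partitionᵇ-sound : ∀ {M} → IsMaxCap M → size M ≡ 20 → ∀ FA FB FC FD → partitionᵇ FA FB FC FD ≡ true →
  IsPartition0 (codeSet FA) (codeSet FB) (codeSet FC) (codeSet FD)
partitionᵇ-sound maxM size≡20 FA FB FC FD h₀ =
  maxCap0ᵇ-sound maxM size≡20 FA ma , maxCap0ᵇ-sound maxM size≡20 FB mb ,
  maxCap0ᵇ-sound maxM size≡20 FC mc , maxCap0ᵇ-sound maxM size≡20 FD md ,
  disjointᵇ-sound A B dab , disjointᵇ-sound A C dac , disjointᵇ-sound A D dad ,
  disjointᵇ-sound B C dbc , disjointᵇ-sound B D dbd , disjointᵇ-sound C D dcd ,
  coversᵇ-sound A B C D cv
  where
  A = codeSet FA ; B = codeSet FB ; C = codeSet FC ; D = codeSet FD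
  ma = ∧-elimˡ (maxCap0ᵇ FA) h₀ ; h₁ = ∧-elimʳ (maxCap0ᵇ FA) h₀
  mb = ∧-elimˡ (maxCap0ᵇ FB) h₁ ; h₂ = ∧-elimʳ (maxCap0ᵇ FB) h₁
  mc = ∧-elimˡ (maxCap0ᵇ FC) h₂ ; h₃ = ∧-elimʳ (maxCap0ᵇ FC) h₂
  md = ∧-elimˡ (maxCap0ᵇ FD) h₃ ; h₄ = ∧-elimʳ (maxCap0ᵇ FD) h₃
  dab = ∧-elimˡ (disjointᵇ A B) h₄ ; h₅ = ∧-elimʳ (disjointᵇ A B) h₄
  dac = ∧-elimˡ (disjointᵇ A C) h₅ ; h₆ = ∧-elimʳ (disjointᵇ A C) h₅
  dad = ∧-elimˡ (disjointᵇ A D) h₆ ; h₇ = ∧-elimʳ (disjointᵇ A D) h₆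
  dbc = ∧-elimˡ (disjointᵇ B C) h₇ ; h₈ = ∧-elimʳ (disjointᵇ B C) h₇
  dbd = ∧-elimˡ (disjointᵇ B D) h₈ ; h₉ = ∧-elimʳ (disjointᵇ B D) h₈
  dcd = ∧-elimˡ (disjointᵇ C D) h₉ ; cv = ∧-elimʳ (disjointᵇ C D) h₉

-- In a partition the last cap is the complement of 𝟘 and the other three.
fourthSet : PSet → PSet → PSet → PSet
fourthSet P Q X x = not (eqP x 𝟘 ∨ (P x ∨ (Q x ∨ X x)))

none-of₄ : ∀ {a b c d} → a ≡ false → b ≡ false → c ≡ false → d ≡ false → not (a ∨ (b ∨ (c ∨ d))) ≡ true
none-of₄ refl refl refl refl = refl

none-of₄⁻ : ∀ a b c {d} → not (a ∨ (b ∨ (c ∨ d))) ≡ true → a ≡ false × b ≡ false × c ≡ false × d ≡ false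
none-of₄⁻ false false false {false} _ = refl , refl , refl , refl

fourth-cap : ∀ {P Q X Y} → ¬ (𝟘 ∈ₛ Y) → Disjoint P Y → Disjoint Q Y → Disjoint X Y → Covers P Q X Y →
  Y ≐ fourthSet P Q X
fourth-cap {P} {Q} {X} {Y} 𝟘∉Y dpy dqy dxy cv x = bool-ext into back
  where
  into : x ∈ₛ Y → fourthSet P Q X x ≡ true
  into x∈Y = none-of₄ (eqP-complete x 𝟘 (λ { refl → 𝟘∉Y x∈Y }))
    (¬true⇒false λ px → dpy x (px , x∈Y)) (¬true⇒false λ qx → dqy x (qx , x∈Y))
    (¬true⇒false λ xx → dxy x (xx , x∈Y))
  back : fourthSet P Q X x ≡ true → x ∈ₛ Y
  back h with none-of₄⁻ (eqP x 𝟘) (P x) (Q x) h | cv x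
  ... | x≢𝟘 , _ , _ , _ | inj₁ x≡𝟘 = ⊥-elim (eqP-false x 𝟘 x≢𝟘 x≡𝟘)
  ... | _ , p , _ , _ | inj₂ (inj₁ px) = ⊥-elim (true≢false (trans (sym px) p))
  ... | _ , _ , q , _ | inj₂ (inj₂ (inj₁ qx)) = ⊥-elim (true≢false (trans (sym qx) q))
  ... | _ , _ , _ , r | inj₂ (inj₂ (inj₂ (inj₁ xx))) = ⊥-elim (true≢false (trans (sym xx) r))
  ... | _ | inj₂ (inj₂ (inj₂ (inj₂ yx))) = yx

outside-of-disjoint : ∀ {P Q X} → Disjoint P X → Disjoint Q X → ∀ x → x ∈ₛ X → not (P x ∨ Q x) ≡ true
outside-of-disjoint {P} {Q} dpx dqx x x∈X =
  subst₂ (λ a b → not (a ∨ b) ≡ true) (sym (¬true⇒false λ px → dpx x (px , x∈X)))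
    (sym (¬true⇒false λ qx → dqx x (qx , x∈X))) refl

containsCodeᵇ : List ℕ → Point → Bool
containsCodeᵇ L x = any (λ a → eqP (decode a) x ∨ eqP (decode a) (⊖ x)) L

coverageᵇ : PSet → List ℕ → Bool
coverageᵇ R L = allP (λ x → not (R x) ∨ (eqP x 𝟘 ∨ containsCodeᵇ L x))

completeLeavesᵇ : List (List ℕ × List ℕ) → Bool
completeLeavesᵇ = all (λ l → null (proj₂ l) ∧ validCodesᵇ (proj₁ l))

module Classification (S : PSet) (capS : IsCap S) (anchorS : HasAnchor 𝟘 S) where
  open CapSearch S capS anchorS

  𝟘∉S : ∀ x → x ∈ₛ S → eqP x 𝟘 ≡ false
  𝟘∉S x x∈S = eqP-complete x 𝟘 (λ { refl → proj₁ anchorS x∈S })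

  leaf-describes : ∀ I → Chosen I → CoveredBy S I → validCodesᵇ I ≡ true → S ≐ codeSet (withNegatives I)
  leaf-describes I I⊆S cov valid x = bool-ext into back
    where
    into : x ∈ₛ S → codeSet (withNegatives I) x ≡ true
    into x∈S with find (cov x x∈S)
    ... | a , a∈I , inj₁ e = elemᵇ-complete (encode x) (withNegatives I)
            (subst (_∈ withNegatives I) (trans (sym (validCodes-sound I valid a∈I)) (cong encode e))
              (∈ₚ.∈-++⁺ˡ a∈I))
    ... | a , a∈I , inj₂ e = elemᵇ-complete (encode x) (withNegatives I)
            (subst (_∈ withNegatives I) (cong encode (trans (cong ⊖_ e) (⊖-involutive x)))
              (∈ₚ.∈-++⁺ʳ I (∈ₚ.∈-map⁺ negCode a∈I)))
    back : codeSet (withNegatives I) x ≡ true → x ∈ₛ S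
    back h with ∈ₚ.∈-++⁻ I (elemᵇ-sound (encode x) (withNegatives I) h)
    ... | inj₁ x∈I = subst (_∈ₛ S) (decode-encode x) (All.lookup I⊆S x∈I)
    ... | inj₂ m with ∈ₚ.∈-map⁻ negCode m
    ...   | a , a∈I , e = subst (_∈ₛ S) negated (S-neg (decode a) (All.lookup I⊆S a∈I))
      where
      negated : ⊖ (decode a) ≡ x
      negated = trans (sym (decode-encode (⊖ decode a))) (trans (cong decode (sym e)) (decode-encode x))

  coveredBy-check : (R : PSet) → (∀ x → x ∈ₛ S → x ∈ₛ R) → ∀ L → coverageᵇ R L ≡ true → CoveredBy S L
  coveredBy-check R S⊆R L h x x∈S
    with ∨-resolve (eqP x 𝟘)
           (∨-resolve (not (R x)) (allP-sound (λ x → not (R x) ∨ (eqP x 𝟘 ∨ containsCodeᵇ L x)) h x)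
             (cong not (S⊆R x x∈S)))
           (𝟘∉S x x∈S)
  ... | hit with any-sound (λ a → eqP (decode a) x ∨ eqP (decode a) (⊖ x)) L hit
  ...   | a , a∈L , match with eqP (decode a) x in same
  ...     | true = lose a∈L (inj₁ (eqP-sound _ _ same))
  ...     | false = lose a∈L (inj₂ (eqP-sound _ _ match))

  classify : 20 ≤ size S → ∀ K n rem leaves → Chosen K →
    length (proj₁ (commit K)) + n ≡ 10 → CoveredBy S (proj₁ (commit K) ++ rem) →
    capSearch n (proj₁ (commit K)) (proj₂ (commit K)) rem ≡ leaves → completeLeavesᵇ leaves ≡ true →
    Any (λ l → S ≐ codeSet (withNegatives (proj₁ l))) leaves
  classify big K n rem leaves K⊆S total cov search≡ complete =
    refine (subst (Any DescribesS) search≡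
             (search-sound n _ _ rem (proj₁ committed) (proj₂ committed) cov total big))
           (all⇒All (λ l → null (proj₂ l) ∧ validCodesᵇ (proj₁ l)) leaves complete)
    where
    committed = commit-sound K K⊆S
    finish : ∀ {l} → DescribesS l → (null (proj₂ l) ∧ validCodesᵇ (proj₁ l)) ≡ true →
      S ≐ codeSet (withNegatives (proj₁ l))
    finish {I , []} (I⊆S , cov) c =
      leaf-describes I I⊆S (subst (CoveredBy S) (Listₚ.++-identityʳ I) cov) c
    finish {_ , _ ∷ _} _ ()
    refine : ∀ {ls} → Any DescribesS ls → All (λ l → (null (proj₂ l) ∧ validCodesᵇ (proj₁ l)) ≡ true) ls →
      Any (λ l → S ≐ codeSet (withNegatives (proj₁ l))) ls
    refine (here d) (c ∷ _) = here (finish d c)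
    refine (there a) (_ ∷ cs) = there (refine a cs)

  classify-among : ∀ {Entry : Set} → 20 ≤ size S → ∀ K n rem (table : List Entry) (leaf : Entry → List ℕ × List ℕ) →
    Chosen K → length (proj₁ (commit K)) + n ≡ 10 → CoveredBy S (proj₁ (commit K) ++ rem) →
    capSearch n (proj₁ (commit K)) (proj₂ (commit K)) rem ≡ List.map leaf table →
    completeLeavesᵇ (List.map leaf table) ≡ true →
    ∃ λ e → e ∈ table × S ≐ codeSet (withNegatives (proj₁ (leaf e)))
  classify-among big K n rem table leaf K⊆S total cov search≡ complete =
    find (Anyₚ.map⁻ (classify big K n rem (List.map leaf table) K⊆S total cov search≡ complete))

  point-outside : 20 ≤ size S → (R : PSet) → (K W : List ℕ) → Chosen K → length W < 20 →
    allP (λ x → not (R x) ∨ (eqP x 𝟘 ∨ (elemᵇ (encode x) W ∨ elemᵇ (encode x) (proj₂ (commit K))))) ≡ true →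
    ∃ λ x → x ∈ₛ S × R x ≡ false
  point-outside big R K W K⊆S W<20 h with any (λ x → S x ∧ not (R x)) allPoints in found
  ... | true with any-sound (λ x → S x ∧ not (R x)) allPoints found
  ...   | x , _ , c = x , ∧-elimˡ _ c , not-true (∧-elimʳ (S x) c)
  point-outside big R K W K⊆S W<20 h | false =
    ⊥-elim (ℕₚ.<⇒≱ W<20 (ℕₚ.≤-trans big
      (subst (size S ≤_) (Listₚ.length-map decode W) (size-≤-list S (List.map decode W) inW))))
    where
    in-R : ∀ x → x ∈ₛ S → R x ≡ true
    in-R x x∈S = not-false (subst (λ b → b ∧ not (R x) ≡ false) x∈S
      (any-false (λ x → S x ∧ not (R x)) allPoints found (allPoints-complete x)))
    inW : ∀ x → x ∈ₛ S → x ∈ List.map decode W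
    inW x x∈S with ∨-resolve (eqP x 𝟘)
                     (∨-resolve (not (R x))
                       (allP-sound (λ x → not (R x) ∨ (eqP x 𝟘 ∨ (elemᵇ (encode x) W ∨
                         elemᵇ (encode x) (proj₂ (commit K))))) h x)
                       (cong not (in-R x x∈S)))
                     (𝟘∉S x x∈S)
    ... | hit with elemᵇ (encode x) W in x∈W
    ...   | true = subst (_∈ List.map decode W) (decode-encode x) (∈ₚ.∈-map⁺ decode (elemᵇ-sound (encode x) W x∈W))
    ...   | false = ⊥-elim (true≢false (trans (sym (trans (inS-encode x) x∈S))
                      (All.lookup (proj₂ (commit-sound K K⊆S)) (elemᵇ-sound (encode x) _ hit))))

_==𝔹_ : Bool → Bool → Bool
true ==𝔹 b = b
false ==𝔹 b = not b

==𝔹-sound : ∀ a b → a ==𝔹 b ≡ true → a ≡ b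
==𝔹-sound true true _ = refl
==𝔹-sound false false _ = refl

==𝔹-refl : ∀ a → a ==𝔹 a ≡ true
==𝔹-refl true = refl
==𝔹-refl false = refl

_≐ᵇ_ : PSet → PSet → Bool
P ≐ᵇ Q = allP (λ x → P x ==𝔹 Q x)

≐ᵇ-sound : ∀ P Q → P ≐ᵇ Q ≡ true → P ≐ Q
≐ᵇ-sound P Q h x = ==𝔹-sound _ _ (allP-sound (λ x → P x ==𝔹 Q x) h x)

≐ᵇ-complete : ∀ P Q → P ≐ Q → P ≐ᵇ Q ≡ true
≐ᵇ-complete P Q e = allP-complete (λ x → P x ==𝔹 Q x) (λ x → subst (λ b → P x ==𝔹 b ≡ true) (e x) (==𝔹-refl (P x)))

samePairᵇ : PSet × PSet → PSet × PSet → Bool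
samePairᵇ (X , Y) (X' , Y') = ((X ≐ᵇ X') ∧ (Y ≐ᵇ Y')) ∨ ((X ≐ᵇ Y') ∧ (Y ≐ᵇ X'))

samePairᵇ-sound : ∀ p q → samePairᵇ p q ≡ true → SamePair p q
samePairᵇ-sound (X , Y) (X' , Y') h with (X ≐ᵇ X') ∧ (Y ≐ᵇ Y') in straight
... | true = inj₁ (≐ᵇ-sound _ _ (∧-elimˡ _ straight) , ≐ᵇ-sound _ _ (∧-elimʳ (X ≐ᵇ X') straight))
... | false = inj₂ (≐ᵇ-sound _ _ (∧-elimˡ _ h) , ≐ᵇ-sound _ _ (∧-elimʳ (X ≐ᵇ Y') h))

samePairᵇ-complete : ∀ p q → SamePair p q → samePairᵇ p q ≡ true
samePairᵇ-complete (X , Y) (X' , Y') (inj₁ (a , b)) =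
  subst₂ (λ u v → (u ∧ v) ∨ ((X ≐ᵇ Y') ∧ (Y ≐ᵇ X')) ≡ true)
    (sym (≐ᵇ-complete X X' a)) (sym (≐ᵇ-complete Y Y' b)) refl
samePairᵇ-complete (X , Y) (X' , Y') (inj₂ (a , b)) =
  subst₂ (λ u v → ((X ≐ᵇ X') ∧ (Y ≐ᵇ Y')) ∨ (u ∧ v) ≡ true)
    (sym (≐ᵇ-complete X Y' a)) (sym (≐ᵇ-complete Y X' b)) (Boolₚ.∨-zeroʳ _)

codePair : List ℕ × List ℕ → PSet × PSet
codePair (F , G) = codeSet F , codeSet G

distinctPairsᵇ : List (List ℕ × List ℕ) → Bool
distinctPairsᵇ [] = true
distinctPairsᵇ (o ∷ os) = all (λ o' → not (samePairᵇ (codePair o) (codePair o'))) os ∧ distinctPairsᵇ os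

distinctPairsᵇ-sound : ∀ os → distinctPairsᵇ os ≡ true →
  AllPairs (λ p q → ¬ SamePair p q) (List.map codePair os)
distinctPairsᵇ-sound [] _ = []
distinctPairsᵇ-sound (o ∷ os) h =
  Allₚ.map⁺ (All.map (λ {o'} differ same →
      true≢false (trans (sym (samePairᵇ-complete (codePair o) (codePair o') same)) (not-true differ)))
    (all⇒All (λ o' → not (samePairᵇ (codePair o) (codePair o'))) os
      (∧-elimˡ (all (λ o' → not (samePairᵇ (codePair o) (codePair o'))) os) h)))
  ∷ distinctPairsᵇ-sound os (∧-elimʳ (all (λ o' → not (samePairᵇ (codePair o) (codePair o'))) os) h)

-- A third cap X is
-- disjoint from P ∪ Q, so the candidates rem need only cover the rest of
-- the space; each leaf of the search, paired with the fourth set it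
-- determines, must match one of the listed pairs.

outsideᵇ : List ℕ → List ℕ → PSet
outsideᵇ FP FQ x = not (codeSet FP x ∨ codeSet FQ x)

leafCompletion : List ℕ → List ℕ → List ℕ × List ℕ → PSet × PSet
leafCompletion FP FQ (I , _) =
  codeSet (withNegatives I) , fourthSet (codeSet FP) (codeSet FQ) (codeSet (withNegatives I))

matchesᵇ : List ℕ → List ℕ → List (List ℕ × List ℕ) → List (List ℕ × List ℕ) → Bool
matchesᵇ FP FQ leaves pairs = all (λ l → any (λ o → samePairᵇ (leafCompletion FP FQ l) (codePair o)) pairs) leaves

completionsᵇ : (FP FQ rem : List ℕ) (leaves pairs : List (List ℕ × List ℕ)) → Bool
completionsᵇ FP FQ rem leaves pairs =
  maxCap0ᵇ FP ∧ (coverageᵇ (outsideᵇ FP FQ) rem ∧ (completeLeavesᵇ leaves ∧ (matchesᵇ FP FQ leaves pairs ∧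
  (all (λ o → partitionᵇ FP FQ (proj₁ o) (proj₂ o)) pairs ∧ distinctPairsᵇ pairs))))

completions-exact : ∀ {M} → IsMaxCap M → size M ≡ 20 → ∀ FP FQ rem leaves pairs →
  capSearch 10 [] [] rem ≡ leaves → completionsᵇ FP FQ rem leaves pairs ≡ true →
  Completable (length pairs) (codeSet FP) (codeSet FQ)
completions-exact maxM size≡20 FP FQ rem leaves pairs search≡ h₀ =
  List.map codePair pairs ,
  Listₚ.length-map codePair pairs ,
  Allₚ.map⁺ (All.map (λ {o} → partitionᵇ-sound maxM size≡20 FP FQ (proj₁ o) (proj₂ o))
    (all⇒All (λ o → partitionᵇ FP FQ (proj₁ o) (proj₂ o)) pairs partitions-ok)) ,
  distinctPairsᵇ-sound pairs distinct-ok ,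
  every
  where
  P-ok = ∧-elimˡ (maxCap0ᵇ FP) h₀ ; h₁ = ∧-elimʳ (maxCap0ᵇ FP) h₀
  region-ok = ∧-elimˡ (coverageᵇ (outsideᵇ FP FQ) rem) h₁
  h₂ = ∧-elimʳ (coverageᵇ (outsideᵇ FP FQ) rem) h₁
  leaves-ok = ∧-elimˡ (completeLeavesᵇ leaves) h₂ ; h₃ = ∧-elimʳ (completeLeavesᵇ leaves) h₂
  matches-ok = ∧-elimˡ (matchesᵇ FP FQ leaves pairs) h₃ ; h₄ = ∧-elimʳ (matchesᵇ FP FQ leaves pairs) h₃
  partitions-ok = ∧-elimˡ (all (λ o → partitionᵇ FP FQ (proj₁ o) (proj₂ o)) pairs) h₄
  distinct-ok = ∧-elimʳ (all (λ o → partitionᵇ FP FQ (proj₁ o) (proj₂ o)) pairs) h₄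
  P = codeSet FP
  Q = codeSet FQ
  every : ∀ X Y → IsPartition0 P Q X Y → Any (SamePair (X , Y)) (List.map codePair pairs)
  every X Y (_ , _ , ((capX , maxX) , anchorX) , (_ , 𝟘∉Y , _) , _ , dpx , dpy , dqx , dqy , dxy , cv) =
    matched (find (Classification.classify X capX anchorX (maxCap-size≥20 (capX , maxX) FP P-ok)
                    [] 10 rem leaves [] refl
                    (Classification.coveredBy-check X capX anchorX (outsideᵇ FP FQ)
                      (outside-of-disjoint dpx dqx) rem region-ok)
                    search≡ leaves-ok))
    where
    -- X is described by a leaf, so (X , Y) is that leaf's completion, which is listed.
    matched : (∃ λ l → l ∈ leaves × X ≐ codeSet (withNegatives (proj₁ l))) →
      Any (SamePair (X , Y)) (List.map codePair pairs)
    matched ((I , E) , l∈leaves , X≐) =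
      Anyₚ.map⁺ (lose o∈pairs (samePair-trans (inj₁ (X≐ , Y≐)) (samePairᵇ-sound _ (codePair o) match)))
      where
      Y≐ : Y ≐ fourthSet P Q (codeSet (withNegatives I))
      Y≐ x = trans (fourth-cap 𝟘∉Y dpy dqy dxy cv x) (cong (λ b → not (eqP x 𝟘 ∨ (P x ∨ (Q x ∨ b)))) (X≐ x))
      listed = any-sound (λ o → samePairᵇ (leafCompletion FP FQ (I , E)) (codePair o)) pairs
        (all-sound (λ l → any (λ o → samePairᵇ (leafCompletion FP FQ l) (codePair o)) pairs) leaves matches-ok l∈leaves)
      o = proj₁ listed
      o∈pairs = proj₁ (proj₂ listed)
      match = proj₂ (proj₂ listed)

-- CountTransfer for a concrete pair {A, B}: its completions are the pairs
-- in outS, and every one of them in turn has exactly |inS| = |outS|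
-- completions.
transfer-certified : ∀ FA FB remO leavesO outS remI leavesI inS →
  capSearch 10 [] [] remO ≡ leavesO → completionsᵇ FA FB remO leavesO outS ≡ true →
  capSearch 10 [] [] remI ≡ leavesI → all (λ o → completionsᵇ (proj₁ o) (proj₂ o) remI leavesI inS) outS ≡ true →
  length inS ≡ length outS → ∀ C D → CountTransfer (codeSet FA) (codeSet FB) C D
transfer-certified FA FB remO leavesO outS remI leavesI inS searchO≡ outS-ok searchI≡ inS-ok same-length
  C D part@((maxA , _) , _) k count-AB =
  subst (λ j → Completable j C D) (trans same-length (completable-unique completions-AB count-AB))
    (completable-samePair CD~o (completions-exact maxA size≡20 FC FD remI leavesI inS searchI≡
      (all-sound (λ o → completionsᵇ (proj₁ o) (proj₂ o) remI leavesI inS) outS inS-ok o∈outS)))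
  where
  size≡20 : size (codeSet FA) ≡ 20
  size≡20 = maxCap0ᵇ-size FA (∧-elimˡ (maxCap0ᵇ FA) outS-ok)
  completions-AB : Completable (length outS) (codeSet FA) (codeSet FB)
  completions-AB = completions-exact maxA size≡20 FA FB remO leavesO outS searchO≡ outS-ok
  -- {C, D} is itself one of the listed completions (FC, FD) of {A, B}.
  found = find (proj₂ (proj₂ (proj₂ (proj₂ completions-AB))) C D part)
  listed = ∈ₚ.∈-map⁻ codePair (proj₁ (proj₂ found))
  FC = proj₁ (proj₁ listed)
  FD = proj₂ (proj₁ listed)
  o∈outS : (FC , FD) ∈ outS
  o∈outS = proj₁ (proj₂ listed)
  CD~o : SamePair (C , D) (codeSet FC , codeSet FD)
  CD~o = subst (SamePair (C , D)) (proj₂ (proj₂ listed)) (proj₂ (proj₂ found))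

-- Every maximal cap has at least 20 points, as witnessed by any
-- certified maximal cap.

Contains : PSet → List ℕ → Set
Contains A K = All (λ a → decode a ∈ₛ A) K

spanᵇ : ℕ → Point → Bool
spanᵇ j x = all (_== zero) (List.drop j (Vec.toList x))

movesOntoᵇ : List ℕ → (List ℕ × List ℕ) × Mat × Mat → Bool
movesOntoᵇ FA ((I , _) , N , N⁻¹) =
  invertibleᵇ N N⁻¹ ∧ ((λ x → codeSet (withNegatives I) (N · x)) ≐ᵇ codeSet FA)

movesPairᵇ : List ℕ → (ℕ → List ℕ) → (List ℕ × List ℕ) × Mat × Mat × ℕ → Bool
movesPairᵇ FA representative ((I , _) , G , G⁻¹ , r) =
  invertibleᵇ G G⁻¹ ∧ (((λ x → codeSet FA (G · x)) ≐ᵇ codeSet FA) ∧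
  ((λ x → codeSet (withNegatives I) (G · x)) ≐ᵇ codeSet (representative r)))

module Normalisation (witness : List ℕ) (witness-ok : maxCap0ᵇ witness ≡ true) where

  maximal-size : ∀ {S} → IsMaxCap S → 20 ≤ size S
  maximal-size maxS = maxCap-size≥20 maxS witness witness-ok

  tableAut : (tab itab : ℕ → Mat) → allP (λ t → invertibleᵇ (tab (encode t)) (itab (encode t))) ≡ true →
    Point → LinAut
  tableAut tab itab inv t =
    matrixAut (tab (encode t)) (itab (encode t)) (allP-sound (λ t → invertibleᵇ (tab (encode t)) (itab (encode t))) inv t)

  fixed-points : ∀ {A} (h : LinAut) K → all (λ a → eqP (LinAut.to h (decode a)) (decode a)) K ≡ true →
    Contains A K → Contains (h ⁻¹[ A ]) K
  fixed-points h [] _ [] = []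
  fixed-points {A} h (a ∷ K) fix (a∈A ∷ K⊆A) =
    subst (_∈ₛ A) (sym (eqP-sound _ _ (∧-elimˡ (eqP (LinAut.to h (decode a)) (decode a)) fix))) a∈A ∷
    fixed-points {A} h K (∧-elimʳ (eqP (LinAut.to h (decode a)) (decode a)) fix) K⊆A

  -- A cap A ⊇ K has a point t outside the span
  -- (its points in the span are among W or forbidden by K, and |W| < 20);
  -- the table provides an automorphism fixing K and sending e to t.
  extend : ∀ K e (span : Point → Bool) W (tab itab : ℕ → Mat) →
    allP (λ t → invertibleᵇ (tab (encode t)) (itab (encode t))) ≡ true → length W < 20 →
    allP (λ x → not (span x) ∨ (eqP x 𝟘 ∨ (elemᵇ (encode x) W ∨ elemᵇ (encode x) (proj₂ (commit K))))) ≡ true →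
    allP (λ t → span t ∨ (all (λ a → eqP (tab (encode t) · decode a) (decode a)) K ∧
                          eqP (tab (encode t) · decode e) t)) ≡ true →
    (∀ A B C D → Contains A (K ++ e ∷ []) → CountTransfer A B C D) →
    ∀ A B C D → Contains A K → CountTransfer A B C D
  extend K e span W tab itab inv W<20 few moves next A B C D K⊆A part@(((capA , maxA) , anchorA) , _) =
    transfer-preimage h (next (h ⁻¹[ A ]) (h ⁻¹[ B ]) (h ⁻¹[ C ]) (h ⁻¹[ D ]) moved) part
    where
    outside = Classification.point-outside A capA anchorA (maximal-size (capA , maxA)) span K W K⊆A W<20 few
    t = proj₁ outside
    M = tab (encode t)
    h = tableAut tab itab inv t
    sends : (all (λ a → eqP (M · decode a) (decode a)) K ∧ eqP (M · decode e) t) ≡ true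
    sends = ∨-resolve (span t)
      (allP-sound (λ t → span t ∨ (all (λ a → eqP (tab (encode t) · decode a) (decode a)) K ∧
                                   eqP (tab (encode t) · decode e) t)) moves t)
      (proj₂ (proj₂ outside))
    moved : Contains (h ⁻¹[ A ]) (K ++ e ∷ [])
    moved = Allₚ.++⁺ (fixed-points {A} h K (∧-elimˡ (all (λ a → eqP (M · decode a) (decode a)) K) sends) K⊆A)
      (subst (_∈ₛ A) (sym (eqP-sound _ _ (∧-elimʳ (all (λ a → eqP (M · decode a) (decode a)) K) sends)))
        (proj₁ (proj₂ outside)) ∷ [])

  classify-onto : ∀ FA K n rem (table : List ((List ℕ × List ℕ) × Mat × Mat)) →
    length (proj₁ (commit K)) + n ≡ 10 → coverageᵇ (λ _ → true) (proj₁ (commit K) ++ rem) ≡ true →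
    capSearch n (proj₁ (commit K)) (proj₂ (commit K)) rem ≡ List.map proj₁ table →
    completeLeavesᵇ (List.map proj₁ table) ≡ true → all (movesOntoᵇ FA) table ≡ true →
    (∀ A B C D → A ≐ codeSet FA → CountTransfer A B C D) →
    ∀ A B C D → Contains A K → CountTransfer A B C D
  classify-onto FA K n rem table total covers search≡ complete moves next A B C D K⊆A
    part@(((capA , maxA) , anchorA) , _) =
    transfer-preimage h (next (h ⁻¹[ A ]) (h ⁻¹[ B ]) (h ⁻¹[ C ]) (h ⁻¹[ D ]) onto) part
    where
    found = Classification.classify-among A capA anchorA (maximal-size (capA , maxA)) K n rem table proj₁ K⊆A total
      (Classification.coveredBy-check A capA anchorA (λ _ → true) (λ _ _ → refl) (proj₁ (commit K) ++ rem) covers) search≡ complete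
    I = proj₁ (proj₁ (proj₁ found))
    N = proj₁ (proj₂ (proj₁ found))
    N⁻¹ = proj₂ (proj₂ (proj₁ found))
    entry-ok : movesOntoᵇ FA (proj₁ found) ≡ true
    entry-ok = all-sound (movesOntoᵇ FA) table moves (proj₁ (proj₂ found))
    h = matrixAut N N⁻¹ (∧-elimˡ (invertibleᵇ N N⁻¹) entry-ok)
    onto : h ⁻¹[ A ] ≐ codeSet FA
    onto x = trans (proj₂ (proj₂ found) (N · x))
      (≐ᵇ-sound (λ x → codeSet (withNegatives I) (N · x)) (codeSet FA)
        (∧-elimʳ (invertibleᵇ N N⁻¹) entry-ok) x)

  -- Moving a point of B to p₀.  B has a point p, which is neither 𝟘 nor in
  -- A = FA; the table holds an automorphism fixing FA and sending p₀ to p.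
  move-into-B : ∀ FA p₀ (tab itab : ℕ → Mat) →
    allP (λ p → invertibleᵇ (tab (encode p)) (itab (encode p))) ≡ true →
    allP (λ p → (λ x → codeSet FA (tab (encode p) · x)) ≐ᵇ codeSet FA) ≡ true →
    allP (λ p → eqP p 𝟘 ∨ (codeSet FA p ∨ eqP (tab (encode p) · decode p₀) p)) ≡ true →
    (∀ A B C D → A ≐ codeSet FA → Contains B (p₀ ∷ []) → CountTransfer A B C D) →
    ∀ A B C D → A ≐ codeSet FA → CountTransfer A B C D
  move-into-B FA p₀ tab itab inv fixes sends next A B C D A≐
    part@(_ , ((capB , maxB) , 𝟘∉B , _) , _ , _ , dab , _) =
    transfer-preimage h (next (h ⁻¹[ A ]) (h ⁻¹[ B ]) (h ⁻¹[ C ]) (h ⁻¹[ D ]) fixed (p₀∈ ∷ [])) part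
    where
    member = some-member B (ℕₚ.<-≤-trans (s≤s z≤n) (maximal-size (capB , maxB)))
    p = proj₁ member
    p∈B = proj₂ member
    M = tab (encode p)
    h = tableAut tab itab inv p
    fixed : h ⁻¹[ A ] ≐ codeSet FA
    fixed x = trans (A≐ (M · x))
      (≐ᵇ-sound (λ x → codeSet FA (M · x)) (codeSet FA)
        (allP-sound (λ p → (λ x → codeSet FA (tab (encode p) · x)) ≐ᵇ codeSet FA) fixes p) x)
    p₀↦p : eqP (M · decode p₀) p ≡ true
    p₀↦p = ∨-resolve (codeSet FA p)
      (∨-resolve (eqP p 𝟘)
        (allP-sound (λ p → eqP p 𝟘 ∨ (codeSet FA p ∨ eqP (tab (encode p) · decode p₀) p)) sends p)
        (eqP-complete p 𝟘 (λ p≡𝟘 → 𝟘∉B (subst (_∈ₛ B) p≡𝟘 p∈B))))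
      (¬true⇒false λ p∈FA → dab p (trans (A≐ p) p∈FA , p∈B))
    p₀∈ : decode p₀ ∈ₛ h ⁻¹[ B ]
    p₀∈ = subst (_∈ₛ B) (sym (eqP-sound _ _ p₀↦p)) p∈B

  classify-pair : ∀ FA K n rem (table : List ((List ℕ × List ℕ) × Mat × Mat × ℕ)) (representative : ℕ → List ℕ) →
    length (proj₁ (commit K)) + n ≡ 10 →
    coverageᵇ (λ x → not (codeSet FA x)) (proj₁ (commit K) ++ rem) ≡ true →
    capSearch n (proj₁ (commit K)) (proj₂ (commit K)) rem ≡ List.map proj₁ table →
    completeLeavesᵇ (List.map proj₁ table) ≡ true → all (movesPairᵇ FA representative) table ≡ true →
    (∀ r C D → CountTransfer (codeSet FA) (codeSet (representative r)) C D) →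
    ∀ A B C D → A ≐ codeSet FA → Contains B K → CountTransfer A B C D
  classify-pair FA K n rem table representative total covers search≡ complete moves next A B C D A≐ K⊆B
    part@(_ , ((capB , maxB) , anchorB) , _ , _ , dab , _) =
    transfer-preimage h (transfer-≐ onto-A onto-B (λ _ → refl) (λ _ → refl) (next r (h ⁻¹[ C ]) (h ⁻¹[ D ]))) part
    where
    outside-A : ∀ x → x ∈ₛ B → not (codeSet FA x) ≡ true
    outside-A x x∈B = cong not (¬true⇒false λ x∈FA → dab x (trans (A≐ x) x∈FA , x∈B))
    found = Classification.classify-among B capB anchorB (maximal-size (capB , maxB)) K n rem table proj₁ K⊆B total
      (Classification.coveredBy-check B capB anchorB (λ x → not (codeSet FA x)) outside-A (proj₁ (commit K) ++ rem) covers) search≡ complete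
    I = proj₁ (proj₁ (proj₁ found))
    G = proj₁ (proj₂ (proj₁ found))
    G⁻¹ = proj₁ (proj₂ (proj₂ (proj₁ found)))
    r = proj₂ (proj₂ (proj₂ (proj₁ found)))
    entry-ok : movesPairᵇ FA representative (proj₁ found) ≡ true
    entry-ok = all-sound (movesPairᵇ FA representative) table moves (proj₁ (proj₂ found))
    h = matrixAut G G⁻¹ (∧-elimˡ (invertibleᵇ G G⁻¹) entry-ok)
    images = ∧-elimʳ (invertibleᵇ G G⁻¹) entry-ok
    onto-A : h ⁻¹[ A ] ≐ codeSet FA
    onto-A x = trans (A≐ (G · x))
      (≐ᵇ-sound (λ x → codeSet FA (G · x)) (codeSet FA) (∧-elimˡ ((λ x → codeSet FA (G · x)) ≐ᵇ codeSet FA) images) x)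
    onto-B : h ⁻¹[ B ] ≐ codeSet (representative r)
    onto-B x = trans (proj₂ (proj₂ found) (G · x))
      (≐ᵇ-sound (λ x → codeSet (withNegatives I) (G · x)) (codeSet (representative r))
        (∧-elimʳ ((λ x → codeSet FA (G · x)) ≐ᵇ codeSet FA) images) x)

mat : ℕ → ℕ → ℕ → ℕ → Mat
mat a b c d = decode a ∷ decode b ∷ decode c ∷ decode d ∷ []

-- Entry n of a table indexed by codes (the identity outside the table).
nth : List Mat → ℕ → Mat
nth [] _ = mat 1 3 9 27
nth (x ∷ xs) zero = x
nth (x ∷ xs) (suc n) = nth xs n

-- Basis steps: for each point t outside the span of e₁,…,e_{j-1}, the
-- matrix number encode t of the j-th table (with its inverse) fixes
-- e₁,…,e_{j-1} and sends e_j to t.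
matrices₁ : List Mat
matrices₁ =
  mat 1 3 9 27 ∷ mat 1 3 9 27 ∷ mat 2 3 9 27 ∷ mat 3 1 9 27 ∷ mat 4 1 9 27 ∷ mat 5 1 9 27 ∷
  mat 6 1 9 27 ∷ mat 7 1 9 27 ∷ mat 8 1 9 27 ∷ mat 9 1 3 27 ∷ mat 10 1 3 27 ∷ mat 11 1 3 27 ∷
  mat 12 1 3 27 ∷ mat 13 1 3 27 ∷ mat 14 1 3 27 ∷ mat 15 1 3 27 ∷ mat 16 1 3 27 ∷ mat 17 1 3 27 ∷
  mat 18 1 3 27 ∷ mat 19 1 3 27 ∷ mat 20 1 3 27 ∷ mat 21 1 3 27 ∷ mat 22 1 3 27 ∷ mat 23 1 3 27 ∷
  mat 24 1 3 27 ∷ mat 25 1 3 27 ∷ mat 26 1 3 27 ∷ mat 27 1 3 9 ∷ mat 28 1 3 9 ∷ mat 29 1 3 9 ∷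
  mat 30 1 3 9 ∷ mat 31 1 3 9 ∷ mat 32 1 3 9 ∷ mat 33 1 3 9 ∷ mat 34 1 3 9 ∷ mat 35 1 3 9 ∷
  mat 36 1 3 9 ∷ mat 37 1 3 9 ∷ mat 38 1 3 9 ∷ mat 39 1 3 9 ∷ mat 40 1 3 9 ∷ mat 41 1 3 9 ∷
  mat 42 1 3 9 ∷ mat 43 1 3 9 ∷ mat 44 1 3 9 ∷ mat 45 1 3 9 ∷ mat 46 1 3 9 ∷ mat 47 1 3 9 ∷
  mat 48 1 3 9 ∷ mat 49 1 3 9 ∷ mat 50 1 3 9 ∷ mat 51 1 3 9 ∷ mat 52 1 3 9 ∷ mat 53 1 3 9 ∷
  mat 54 1 3 9 ∷ mat 55 1 3 9 ∷ mat 56 1 3 9 ∷ mat 57 1 3 9 ∷ mat 58 1 3 9 ∷ mat 59 1 3 9 ∷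
  mat 60 1 3 9 ∷ mat 61 1 3 9 ∷ mat 62 1 3 9 ∷ mat 63 1 3 9 ∷ mat 64 1 3 9 ∷ mat 65 1 3 9 ∷
  mat 66 1 3 9 ∷ mat 67 1 3 9 ∷ mat 68 1 3 9 ∷ mat 69 1 3 9 ∷ mat 70 1 3 9 ∷ mat 71 1 3 9 ∷
  mat 72 1 3 9 ∷ mat 73 1 3 9 ∷ mat 74 1 3 9 ∷ mat 75 1 3 9 ∷ mat 76 1 3 9 ∷ mat 77 1 3 9 ∷
  mat 78 1 3 9 ∷ mat 79 1 3 9 ∷ mat 80 1 3 9 ∷ []

inverses₁ : List Mat
inverses₁ =
  mat 1 3 9 27 ∷ mat 1 3 9 27 ∷ mat 2 3 9 27 ∷ mat 3 1 9 27 ∷ mat 3 7 9 27 ∷ mat 3 4 9 27 ∷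
  mat 3 2 9 27 ∷ mat 3 5 9 27 ∷ mat 3 8 9 27 ∷ mat 3 9 1 27 ∷ mat 3 9 7 27 ∷ mat 3 9 4 27 ∷
  mat 3 9 19 27 ∷ mat 3 9 25 27 ∷ mat 3 9 22 27 ∷ mat 3 9 10 27 ∷ mat 3 9 16 27 ∷ mat 3 9 13 27 ∷
  mat 3 9 2 27 ∷ mat 3 9 5 27 ∷ mat 3 9 8 27 ∷ mat 3 9 11 27 ∷ mat 3 9 14 27 ∷ mat 3 9 17 27 ∷
  mat 3 9 20 27 ∷ mat 3 9 23 27 ∷ mat 3 9 26 27 ∷ mat 3 9 27 1 ∷ mat 3 9 27 7 ∷ mat 3 9 27 4 ∷
  mat 3 9 27 19 ∷ mat 3 9 27 25 ∷ mat 3 9 27 22 ∷ mat 3 9 27 10 ∷ mat 3 9 27 16 ∷ mat 3 9 27 13 ∷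
  mat 3 9 27 55 ∷ mat 3 9 27 61 ∷ mat 3 9 27 58 ∷ mat 3 9 27 73 ∷ mat 3 9 27 79 ∷ mat 3 9 27 76 ∷
  mat 3 9 27 64 ∷ mat 3 9 27 70 ∷ mat 3 9 27 67 ∷ mat 3 9 27 28 ∷ mat 3 9 27 34 ∷ mat 3 9 27 31 ∷
  mat 3 9 27 46 ∷ mat 3 9 27 52 ∷ mat 3 9 27 49 ∷ mat 3 9 27 37 ∷ mat 3 9 27 43 ∷ mat 3 9 27 40 ∷
  mat 3 9 27 2 ∷ mat 3 9 27 5 ∷ mat 3 9 27 8 ∷ mat 3 9 27 11 ∷ mat 3 9 27 14 ∷ mat 3 9 27 17 ∷
  mat 3 9 27 20 ∷ mat 3 9 27 23 ∷ mat 3 9 27 26 ∷ mat 3 9 27 29 ∷ mat 3 9 27 32 ∷ mat 3 9 27 35 ∷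
  mat 3 9 27 38 ∷ mat 3 9 27 41 ∷ mat 3 9 27 44 ∷ mat 3 9 27 47 ∷ mat 3 9 27 50 ∷ mat 3 9 27 53 ∷
  mat 3 9 27 56 ∷ mat 3 9 27 59 ∷ mat 3 9 27 62 ∷ mat 3 9 27 65 ∷ mat 3 9 27 68 ∷ mat 3 9 27 71 ∷
  mat 3 9 27 74 ∷ mat 3 9 27 77 ∷ mat 3 9 27 80 ∷ []

matrices₂ : List Mat
matrices₂ =
  mat 1 3 9 27 ∷ mat 1 3 9 27 ∷ mat 1 3 9 27 ∷ mat 1 3 9 27 ∷ mat 1 4 9 27 ∷ mat 1 5 9 27 ∷
  mat 1 6 9 27 ∷ mat 1 7 9 27 ∷ mat 1 8 9 27 ∷ mat 1 9 3 27 ∷ mat 1 10 3 27 ∷ mat 1 11 3 27 ∷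
  mat 1 12 3 27 ∷ mat 1 13 3 27 ∷ mat 1 14 3 27 ∷ mat 1 15 3 27 ∷ mat 1 16 3 27 ∷ mat 1 17 3 27 ∷
  mat 1 18 3 27 ∷ mat 1 19 3 27 ∷ mat 1 20 3 27 ∷ mat 1 21 3 27 ∷ mat 1 22 3 27 ∷ mat 1 23 3 27 ∷
  mat 1 24 3 27 ∷ mat 1 25 3 27 ∷ mat 1 26 3 27 ∷ mat 1 27 3 9 ∷ mat 1 28 3 9 ∷ mat 1 29 3 9 ∷
  mat 1 30 3 9 ∷ mat 1 31 3 9 ∷ mat 1 32 3 9 ∷ mat 1 33 3 9 ∷ mat 1 34 3 9 ∷ mat 1 35 3 9 ∷
  mat 1 36 3 9 ∷ mat 1 37 3 9 ∷ mat 1 38 3 9 ∷ mat 1 39 3 9 ∷ mat 1 40 3 9 ∷ mat 1 41 3 9 ∷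
  mat 1 42 3 9 ∷ mat 1 43 3 9 ∷ mat 1 44 3 9 ∷ mat 1 45 3 9 ∷ mat 1 46 3 9 ∷ mat 1 47 3 9 ∷
  mat 1 48 3 9 ∷ mat 1 49 3 9 ∷ mat 1 50 3 9 ∷ mat 1 51 3 9 ∷ mat 1 52 3 9 ∷ mat 1 53 3 9 ∷
  mat 1 54 3 9 ∷ mat 1 55 3 9 ∷ mat 1 56 3 9 ∷ mat 1 57 3 9 ∷ mat 1 58 3 9 ∷ mat 1 59 3 9 ∷
  mat 1 60 3 9 ∷ mat 1 61 3 9 ∷ mat 1 62 3 9 ∷ mat 1 63 3 9 ∷ mat 1 64 3 9 ∷ mat 1 65 3 9 ∷
  mat 1 66 3 9 ∷ mat 1 67 3 9 ∷ mat 1 68 3 9 ∷ mat 1 69 3 9 ∷ mat 1 70 3 9 ∷ mat 1 71 3 9 ∷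
  mat 1 72 3 9 ∷ mat 1 73 3 9 ∷ mat 1 74 3 9 ∷ mat 1 75 3 9 ∷ mat 1 76 3 9 ∷ mat 1 77 3 9 ∷
  mat 1 78 3 9 ∷ mat 1 79 3 9 ∷ mat 1 80 3 9 ∷ []

inverses₂ : List Mat
inverses₂ =
  mat 1 3 9 27 ∷ mat 1 3 9 27 ∷ mat 1 3 9 27 ∷ mat 1 3 9 27 ∷ mat 1 5 9 27 ∷ mat 1 4 9 27 ∷
  mat 1 6 9 27 ∷ mat 1 7 9 27 ∷ mat 1 8 9 27 ∷ mat 1 9 3 27 ∷ mat 1 9 5 27 ∷ mat 1 9 4 27 ∷
  mat 1 9 21 27 ∷ mat 1 9 23 27 ∷ mat 1 9 22 27 ∷ mat 1 9 12 27 ∷ mat 1 9 14 27 ∷ mat 1 9 13 27 ∷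
  mat 1 9 6 27 ∷ mat 1 9 7 27 ∷ mat 1 9 8 27 ∷ mat 1 9 15 27 ∷ mat 1 9 16 27 ∷ mat 1 9 17 27 ∷
  mat 1 9 24 27 ∷ mat 1 9 25 27 ∷ mat 1 9 26 27 ∷ mat 1 9 27 3 ∷ mat 1 9 27 5 ∷ mat 1 9 27 4 ∷
  mat 1 9 27 21 ∷ mat 1 9 27 23 ∷ mat 1 9 27 22 ∷ mat 1 9 27 12 ∷ mat 1 9 27 14 ∷ mat 1 9 27 13 ∷
  mat 1 9 27 57 ∷ mat 1 9 27 59 ∷ mat 1 9 27 58 ∷ mat 1 9 27 75 ∷ mat 1 9 27 77 ∷ mat 1 9 27 76 ∷
  mat 1 9 27 66 ∷ mat 1 9 27 68 ∷ mat 1 9 27 67 ∷ mat 1 9 27 30 ∷ mat 1 9 27 32 ∷ mat 1 9 27 31 ∷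
  mat 1 9 27 48 ∷ mat 1 9 27 50 ∷ mat 1 9 27 49 ∷ mat 1 9 27 39 ∷ mat 1 9 27 41 ∷ mat 1 9 27 40 ∷
  mat 1 9 27 6 ∷ mat 1 9 27 7 ∷ mat 1 9 27 8 ∷ mat 1 9 27 15 ∷ mat 1 9 27 16 ∷ mat 1 9 27 17 ∷
  mat 1 9 27 24 ∷ mat 1 9 27 25 ∷ mat 1 9 27 26 ∷ mat 1 9 27 33 ∷ mat 1 9 27 34 ∷ mat 1 9 27 35 ∷
  mat 1 9 27 42 ∷ mat 1 9 27 43 ∷ mat 1 9 27 44 ∷ mat 1 9 27 51 ∷ mat 1 9 27 52 ∷ mat 1 9 27 53 ∷
  mat 1 9 27 60 ∷ mat 1 9 27 61 ∷ mat 1 9 27 62 ∷ mat 1 9 27 69 ∷ mat 1 9 27 70 ∷ mat 1 9 27 71 ∷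
  mat 1 9 27 78 ∷ mat 1 9 27 79 ∷ mat 1 9 27 80 ∷ []

matrices₃ : List Mat
matrices₃ =
  mat 1 3 9 27 ∷ mat 1 3 9 27 ∷ mat 1 3 9 27 ∷ mat 1 3 9 27 ∷ mat 1 3 9 27 ∷ mat 1 3 9 27 ∷
  mat 1 3 9 27 ∷ mat 1 3 9 27 ∷ mat 1 3 9 27 ∷ mat 1 3 9 27 ∷ mat 1 3 10 27 ∷ mat 1 3 11 27 ∷
  mat 1 3 12 27 ∷ mat 1 3 13 27 ∷ mat 1 3 14 27 ∷ mat 1 3 15 27 ∷ mat 1 3 16 27 ∷ mat 1 3 17 27 ∷
  mat 1 3 18 27 ∷ mat 1 3 19 27 ∷ mat 1 3 20 27 ∷ mat 1 3 21 27 ∷ mat 1 3 22 27 ∷ mat 1 3 23 27 ∷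
  mat 1 3 24 27 ∷ mat 1 3 25 27 ∷ mat 1 3 26 27 ∷ mat 1 3 27 9 ∷ mat 1 3 28 9 ∷ mat 1 3 29 9 ∷
  mat 1 3 30 9 ∷ mat 1 3 31 9 ∷ mat 1 3 32 9 ∷ mat 1 3 33 9 ∷ mat 1 3 34 9 ∷ mat 1 3 35 9 ∷
  mat 1 3 36 9 ∷ mat 1 3 37 9 ∷ mat 1 3 38 9 ∷ mat 1 3 39 9 ∷ mat 1 3 40 9 ∷ mat 1 3 41 9 ∷
  mat 1 3 42 9 ∷ mat 1 3 43 9 ∷ mat 1 3 44 9 ∷ mat 1 3 45 9 ∷ mat 1 3 46 9 ∷ mat 1 3 47 9 ∷
  mat 1 3 48 9 ∷ mat 1 3 49 9 ∷ mat 1 3 50 9 ∷ mat 1 3 51 9 ∷ mat 1 3 52 9 ∷ mat 1 3 53 9 ∷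
  mat 1 3 54 9 ∷ mat 1 3 55 9 ∷ mat 1 3 56 9 ∷ mat 1 3 57 9 ∷ mat 1 3 58 9 ∷ mat 1 3 59 9 ∷
  mat 1 3 60 9 ∷ mat 1 3 61 9 ∷ mat 1 3 62 9 ∷ mat 1 3 63 9 ∷ mat 1 3 64 9 ∷ mat 1 3 65 9 ∷
  mat 1 3 66 9 ∷ mat 1 3 67 9 ∷ mat 1 3 68 9 ∷ mat 1 3 69 9 ∷ mat 1 3 70 9 ∷ mat 1 3 71 9 ∷
  mat 1 3 72 9 ∷ mat 1 3 73 9 ∷ mat 1 3 74 9 ∷ mat 1 3 75 9 ∷ mat 1 3 76 9 ∷ mat 1 3 77 9 ∷
  mat 1 3 78 9 ∷ mat 1 3 79 9 ∷ mat 1 3 80 9 ∷ []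

inverses₃ : List Mat
inverses₃ =
  mat 1 3 9 27 ∷ mat 1 3 9 27 ∷ mat 1 3 9 27 ∷ mat 1 3 9 27 ∷ mat 1 3 9 27 ∷ mat 1 3 9 27 ∷
  mat 1 3 9 27 ∷ mat 1 3 9 27 ∷ mat 1 3 9 27 ∷ mat 1 3 9 27 ∷ mat 1 3 11 27 ∷ mat 1 3 10 27 ∷
  mat 1 3 15 27 ∷ mat 1 3 17 27 ∷ mat 1 3 16 27 ∷ mat 1 3 12 27 ∷ mat 1 3 14 27 ∷ mat 1 3 13 27 ∷
  mat 1 3 18 27 ∷ mat 1 3 19 27 ∷ mat 1 3 20 27 ∷ mat 1 3 21 27 ∷ mat 1 3 22 27 ∷ mat 1 3 23 27 ∷
  mat 1 3 24 27 ∷ mat 1 3 25 27 ∷ mat 1 3 26 27 ∷ mat 1 3 27 9 ∷ mat 1 3 27 11 ∷ mat 1 3 27 10 ∷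
  mat 1 3 27 15 ∷ mat 1 3 27 17 ∷ mat 1 3 27 16 ∷ mat 1 3 27 12 ∷ mat 1 3 27 14 ∷ mat 1 3 27 13 ∷
  mat 1 3 27 63 ∷ mat 1 3 27 65 ∷ mat 1 3 27 64 ∷ mat 1 3 27 69 ∷ mat 1 3 27 71 ∷ mat 1 3 27 70 ∷
  mat 1 3 27 66 ∷ mat 1 3 27 68 ∷ mat 1 3 27 67 ∷ mat 1 3 27 36 ∷ mat 1 3 27 38 ∷ mat 1 3 27 37 ∷
  mat 1 3 27 42 ∷ mat 1 3 27 44 ∷ mat 1 3 27 43 ∷ mat 1 3 27 39 ∷ mat 1 3 27 41 ∷ mat 1 3 27 40 ∷
  mat 1 3 27 18 ∷ mat 1 3 27 19 ∷ mat 1 3 27 20 ∷ mat 1 3 27 21 ∷ mat 1 3 27 22 ∷ mat 1 3 27 23 ∷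
  mat 1 3 27 24 ∷ mat 1 3 27 25 ∷ mat 1 3 27 26 ∷ mat 1 3 27 45 ∷ mat 1 3 27 46 ∷ mat 1 3 27 47 ∷
  mat 1 3 27 48 ∷ mat 1 3 27 49 ∷ mat 1 3 27 50 ∷ mat 1 3 27 51 ∷ mat 1 3 27 52 ∷ mat 1 3 27 53 ∷
  mat 1 3 27 72 ∷ mat 1 3 27 73 ∷ mat 1 3 27 74 ∷ mat 1 3 27 75 ∷ mat 1 3 27 76 ∷ mat 1 3 27 77 ∷
  mat 1 3 27 78 ∷ mat 1 3 27 79 ∷ mat 1 3 27 80 ∷ []

matrices₄ : List Mat
matrices₄ =
  mat 1 3 9 27 ∷ mat 1 3 9 27 ∷ mat 1 3 9 27 ∷ mat 1 3 9 27 ∷ mat 1 3 9 27 ∷ mat 1 3 9 27 ∷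
  mat 1 3 9 27 ∷ mat 1 3 9 27 ∷ mat 1 3 9 27 ∷ mat 1 3 9 27 ∷ mat 1 3 9 27 ∷ mat 1 3 9 27 ∷
  mat 1 3 9 27 ∷ mat 1 3 9 27 ∷ mat 1 3 9 27 ∷ mat 1 3 9 27 ∷ mat 1 3 9 27 ∷ mat 1 3 9 27 ∷
  mat 1 3 9 27 ∷ mat 1 3 9 27 ∷ mat 1 3 9 27 ∷ mat 1 3 9 27 ∷ mat 1 3 9 27 ∷ mat 1 3 9 27 ∷
  mat 1 3 9 27 ∷ mat 1 3 9 27 ∷ mat 1 3 9 27 ∷ mat 1 3 9 27 ∷ mat 1 3 9 28 ∷ mat 1 3 9 29 ∷
  mat 1 3 9 30 ∷ mat 1 3 9 31 ∷ mat 1 3 9 32 ∷ mat 1 3 9 33 ∷ mat 1 3 9 34 ∷ mat 1 3 9 35 ∷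
  mat 1 3 9 36 ∷ mat 1 3 9 37 ∷ mat 1 3 9 38 ∷ mat 1 3 9 39 ∷ mat 1 3 9 40 ∷ mat 1 3 9 41 ∷
  mat 1 3 9 42 ∷ mat 1 3 9 43 ∷ mat 1 3 9 44 ∷ mat 1 3 9 45 ∷ mat 1 3 9 46 ∷ mat 1 3 9 47 ∷
  mat 1 3 9 48 ∷ mat 1 3 9 49 ∷ mat 1 3 9 50 ∷ mat 1 3 9 51 ∷ mat 1 3 9 52 ∷ mat 1 3 9 53 ∷
  mat 1 3 9 54 ∷ mat 1 3 9 55 ∷ mat 1 3 9 56 ∷ mat 1 3 9 57 ∷ mat 1 3 9 58 ∷ mat 1 3 9 59 ∷
  mat 1 3 9 60 ∷ mat 1 3 9 61 ∷ mat 1 3 9 62 ∷ mat 1 3 9 63 ∷ mat 1 3 9 64 ∷ mat 1 3 9 65 ∷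
  mat 1 3 9 66 ∷ mat 1 3 9 67 ∷ mat 1 3 9 68 ∷ mat 1 3 9 69 ∷ mat 1 3 9 70 ∷ mat 1 3 9 71 ∷
  mat 1 3 9 72 ∷ mat 1 3 9 73 ∷ mat 1 3 9 74 ∷ mat 1 3 9 75 ∷ mat 1 3 9 76 ∷ mat 1 3 9 77 ∷
  mat 1 3 9 78 ∷ mat 1 3 9 79 ∷ mat 1 3 9 80 ∷ []

inverses₄ : List Mat
inverses₄ =
  mat 1 3 9 27 ∷ mat 1 3 9 27 ∷ mat 1 3 9 27 ∷ mat 1 3 9 27 ∷ mat 1 3 9 27 ∷ mat 1 3 9 27 ∷
  mat 1 3 9 27 ∷ mat 1 3 9 27 ∷ mat 1 3 9 27 ∷ mat 1 3 9 27 ∷ mat 1 3 9 27 ∷ mat 1 3 9 27 ∷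
  mat 1 3 9 27 ∷ mat 1 3 9 27 ∷ mat 1 3 9 27 ∷ mat 1 3 9 27 ∷ mat 1 3 9 27 ∷ mat 1 3 9 27 ∷
  mat 1 3 9 27 ∷ mat 1 3 9 27 ∷ mat 1 3 9 27 ∷ mat 1 3 9 27 ∷ mat 1 3 9 27 ∷ mat 1 3 9 27 ∷
  mat 1 3 9 27 ∷ mat 1 3 9 27 ∷ mat 1 3 9 27 ∷ mat 1 3 9 27 ∷ mat 1 3 9 29 ∷ mat 1 3 9 28 ∷
  mat 1 3 9 33 ∷ mat 1 3 9 35 ∷ mat 1 3 9 34 ∷ mat 1 3 9 30 ∷ mat 1 3 9 32 ∷ mat 1 3 9 31 ∷
  mat 1 3 9 45 ∷ mat 1 3 9 47 ∷ mat 1 3 9 46 ∷ mat 1 3 9 51 ∷ mat 1 3 9 53 ∷ mat 1 3 9 52 ∷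
  mat 1 3 9 48 ∷ mat 1 3 9 50 ∷ mat 1 3 9 49 ∷ mat 1 3 9 36 ∷ mat 1 3 9 38 ∷ mat 1 3 9 37 ∷
  mat 1 3 9 42 ∷ mat 1 3 9 44 ∷ mat 1 3 9 43 ∷ mat 1 3 9 39 ∷ mat 1 3 9 41 ∷ mat 1 3 9 40 ∷
  mat 1 3 9 54 ∷ mat 1 3 9 55 ∷ mat 1 3 9 56 ∷ mat 1 3 9 57 ∷ mat 1 3 9 58 ∷ mat 1 3 9 59 ∷
  mat 1 3 9 60 ∷ mat 1 3 9 61 ∷ mat 1 3 9 62 ∷ mat 1 3 9 63 ∷ mat 1 3 9 64 ∷ mat 1 3 9 65 ∷
  mat 1 3 9 66 ∷ mat 1 3 9 67 ∷ mat 1 3 9 68 ∷ mat 1 3 9 69 ∷ mat 1 3 9 70 ∷ mat 1 3 9 71 ∷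
  mat 1 3 9 72 ∷ mat 1 3 9 73 ∷ mat 1 3 9 74 ∷ mat 1 3 9 75 ∷ mat 1 3 9 76 ∷ mat 1 3 9 77 ∷
  mat 1 3 9 78 ∷ mat 1 3 9 79 ∷ mat 1 3 9 80 ∷ []

-- The normal form A₀ of the first cap; it contains e₁ = 1, e₂ = 3, e₃ = 9, e₄ = 27.
A₀ : List ℕ
A₀ = (52 ∷ 70 ∷ 22 ∷ 58 ∷ 37 ∷ 39 ∷ 1 ∷ 3 ∷ 9 ∷ 27 ∷ 68 ∷ 50 ∷ 17 ∷ 35 ∷ 74 ∷ 78 ∷ 2 ∷ 6 ∷ 18 ∷ 54 ∷ [])

-- Search data for the caps containing e₁,…,e₄: each leaf, with a matrix
-- (and inverse) moving the cap it describes onto A₀.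
candidatesA : List ℕ
candidatesA = (36 ∷ 63 ∷ 30 ∷ 57 ∷ 12 ∷ 39 ∷ 66 ∷ 21 ∷ 48 ∷ 75 ∷ 28 ∷ 55 ∷ 10 ∷ 37 ∷ 64 ∷ 19 ∷ 46 ∷ 73 ∷ 4 ∷ 31 ∷ 58 ∷ 13 ∷ 40 ∷ 67 ∷ 22 ∷ 49 ∷ 76 ∷ 7 ∷ 34 ∷ 61 ∷ 16 ∷ 43 ∷ 70 ∷ 25 ∷ 52 ∷ 79 ∷ [])

classesA : List ((List ℕ × List ℕ) × Mat × Mat)
classesA =
  (((52 ∷ 70 ∷ 22 ∷ 58 ∷ 37 ∷ 39 ∷ 1 ∷ 3 ∷ 9 ∷ 27 ∷ []) , []) , mat 1 3 9 27 , mat 1 3 9 27) ∷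
  (((52 ∷ 16 ∷ 76 ∷ 31 ∷ 64 ∷ 39 ∷ 1 ∷ 3 ∷ 9 ∷ 27 ∷ []) , []) , mat 2 31 27 18 , mat 2 22 54 9) ∷
  (((25 ∷ 43 ∷ 49 ∷ 58 ∷ 64 ∷ 39 ∷ 1 ∷ 3 ∷ 9 ∷ 27 ∷ []) , []) , mat 58 6 54 18 , mat 22 6 54 18) ∷
  (((70 ∷ 34 ∷ 76 ∷ 13 ∷ 46 ∷ 39 ∷ 1 ∷ 3 ∷ 9 ∷ 27 ∷ []) , []) , mat 2 13 9 54 , mat 2 22 9 54) ∷
  (((43 ∷ 61 ∷ 22 ∷ 67 ∷ 46 ∷ 39 ∷ 1 ∷ 3 ∷ 9 ∷ 27 ∷ []) , []) , mat 67 78 9 27 , mat 58 78 9 27) ∷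
  (((16 ∷ 34 ∷ 49 ∷ 67 ∷ 73 ∷ 39 ∷ 1 ∷ 3 ∷ 9 ∷ 27 ∷ []) , []) , mat 1 39 54 18 , mat 1 39 54 18) ∷
  (((25 ∷ 70 ∷ 76 ∷ 31 ∷ 37 ∷ 66 ∷ 1 ∷ 3 ∷ 9 ∷ 27 ∷ []) , []) , mat 31 6 27 18 , mat 22 6 54 9) ∷
  (((79 ∷ 16 ∷ 49 ∷ 58 ∷ 37 ∷ 66 ∷ 1 ∷ 3 ∷ 9 ∷ 27 ∷ []) , []) , mat 2 58 54 18 , mat 2 22 54 18) ∷
  (((79 ∷ 43 ∷ 22 ∷ 31 ∷ 64 ∷ 66 ∷ 1 ∷ 3 ∷ 9 ∷ 27 ∷ []) , []) , mat 1 3 9 54 , mat 1 3 9 54) ∷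
  (((16 ∷ 61 ∷ 76 ∷ 40 ∷ 46 ∷ 66 ∷ 1 ∷ 3 ∷ 9 ∷ 27 ∷ []) , []) , mat 1 66 27 18 , mat 1 39 54 9) ∷
  (((43 ∷ 61 ∷ 49 ∷ 13 ∷ 73 ∷ 66 ∷ 1 ∷ 3 ∷ 9 ∷ 27 ∷ []) , []) , mat 2 13 9 27 , mat 2 22 9 27) ∷
  (((70 ∷ 34 ∷ 22 ∷ 40 ∷ 73 ∷ 66 ∷ 1 ∷ 3 ∷ 9 ∷ 27 ∷ []) , []) , mat 40 51 9 54 , mat 58 78 9 54) ∷
  (((52 ∷ 61 ∷ 76 ∷ 13 ∷ 37 ∷ 48 ∷ 1 ∷ 3 ∷ 9 ∷ 27 ∷ []) , []) , mat 13 6 54 9 , mat 58 6 27 18) ∷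
  (((79 ∷ 34 ∷ 22 ∷ 67 ∷ 37 ∷ 48 ∷ 1 ∷ 3 ∷ 9 ∷ 27 ∷ []) , []) , mat 2 22 18 54 , mat 2 22 18 54) ∷
  (((25 ∷ 34 ∷ 76 ∷ 40 ∷ 64 ∷ 48 ∷ 1 ∷ 3 ∷ 9 ∷ 27 ∷ []) , []) , mat 1 48 54 9 , mat 1 39 27 18) ∷
  (((79 ∷ 43 ∷ 13 ∷ 58 ∷ 46 ∷ 48 ∷ 1 ∷ 3 ∷ 9 ∷ 27 ∷ []) , []) , mat 1 3 27 18 , mat 1 3 54 9) ∷
  (((25 ∷ 43 ∷ 67 ∷ 31 ∷ 73 ∷ 48 ∷ 1 ∷ 3 ∷ 9 ∷ 27 ∷ []) , []) , mat 2 31 9 27 , mat 2 58 9 27) ∷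
  (((52 ∷ 16 ∷ 40 ∷ 58 ∷ 73 ∷ 48 ∷ 1 ∷ 3 ∷ 9 ∷ 27 ∷ []) , []) , mat 58 6 9 54 , mat 58 6 9 54) ∷
  (((25 ∷ 61 ∷ 49 ∷ 67 ∷ 37 ∷ 75 ∷ 1 ∷ 3 ∷ 9 ∷ 27 ∷ []) , []) , mat 1 75 27 9 , mat 1 39 27 9) ∷
  (((79 ∷ 34 ∷ 49 ∷ 13 ∷ 64 ∷ 75 ∷ 1 ∷ 3 ∷ 9 ∷ 27 ∷ []) , []) , mat 13 6 27 9 , mat 58 6 27 9) ∷
  (((52 ∷ 61 ∷ 22 ∷ 40 ∷ 64 ∷ 75 ∷ 1 ∷ 3 ∷ 9 ∷ 27 ∷ []) , []) , mat 2 22 18 27 , mat 2 22 18 27) ∷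
  (((79 ∷ 16 ∷ 67 ∷ 31 ∷ 46 ∷ 75 ∷ 1 ∷ 3 ∷ 9 ∷ 27 ∷ []) , []) , mat 31 6 9 27 , mat 58 6 9 27) ∷
  (((25 ∷ 70 ∷ 40 ∷ 58 ∷ 46 ∷ 75 ∷ 1 ∷ 3 ∷ 9 ∷ 27 ∷ []) , []) , mat 2 58 9 54 , mat 2 58 9 54) ∷
  (((52 ∷ 70 ∷ 13 ∷ 31 ∷ 73 ∷ 75 ∷ 1 ∷ 3 ∷ 9 ∷ 27 ∷ []) , []) , mat 1 3 54 18 , mat 1 3 54 18) ∷ []

-- The point p₀ ∉ A₀ moved into the second cap, and for each point p ∉ A₀
-- a matrix fixing A₀ and sending p₀ to p.
p₀ : ℕ
p₀ = 36

stabiliserMatrices : List Mat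
stabiliserMatrices =
  mat 1 3 9 27 ∷ mat 1 3 9 27 ∷ mat 1 3 9 27 ∷ mat 1 3 9 27 ∷ mat 2 17 27 58 ∷ mat 1 37 52 70 ∷
  mat 1 3 9 27 ∷ mat 2 39 50 68 ∷ mat 1 9 35 54 ∷ mat 1 3 9 27 ∷ mat 2 27 35 68 ∷ mat 1 6 50 78 ∷
  mat 6 27 35 70 ∷ mat 9 37 52 78 ∷ mat 3 35 27 68 ∷ mat 2 3 52 74 ∷ mat 1 35 27 70 ∷ mat 1 3 9 27 ∷
  mat 1 3 9 27 ∷ mat 2 3 39 70 ∷ mat 1 35 27 74 ∷ mat 1 6 37 68 ∷ mat 1 3 9 27 ∷ mat 2 27 35 78 ∷
  mat 3 35 27 78 ∷ mat 6 27 35 74 ∷ mat 18 50 39 68 ∷ mat 1 3 9 27 ∷ mat 2 9 17 50 ∷ mat 1 6 68 78 ∷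
  mat 6 9 17 52 ∷ mat 27 37 70 78 ∷ mat 3 17 9 50 ∷ mat 2 3 70 74 ∷ mat 1 17 9 52 ∷ mat 1 3 9 27 ∷
  mat 1 3 9 27 ∷ mat 1 3 9 27 ∷ mat 2 17 58 70 ∷ mat 1 3 9 27 ∷ mat 2 6 17 35 ∷ mat 1 9 54 68 ∷
  mat 6 17 58 68 ∷ mat 3 9 54 70 ∷ mat 18 22 74 78 ∷ mat 9 17 68 70 ∷ mat 6 18 58 78 ∷ mat 3 22 54 74 ∷
  mat 2 18 58 74 ∷ mat 1 3 22 27 ∷ mat 1 3 9 27 ∷ mat 1 22 54 78 ∷ mat 1 3 9 27 ∷ mat 2 6 18 35 ∷
  mat 1 3 9 27 ∷ mat 2 3 39 52 ∷ mat 1 17 9 74 ∷ mat 1 6 37 50 ∷ mat 1 3 9 27 ∷ mat 2 9 17 78 ∷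
  mat 3 17 9 78 ∷ mat 6 9 17 74 ∷ mat 54 68 39 50 ∷ mat 18 22 50 52 ∷ mat 6 17 27 37 ∷ mat 3 9 35 39 ∷
  mat 2 17 27 39 ∷ mat 1 3 9 58 ∷ mat 1 3 9 27 ∷ mat 1 9 35 37 ∷ mat 1 3 9 27 ∷ mat 2 6 17 54 ∷
  mat 2 6 18 54 ∷ mat 1 22 35 50 ∷ mat 1 3 9 27 ∷ mat 3 22 35 52 ∷ mat 9 17 37 39 ∷ mat 6 18 27 50 ∷
  mat 1 3 9 27 ∷ mat 2 18 27 52 ∷ mat 1 3 22 58 ∷ []

stabiliserInverses : List Mat
stabiliserInverses =
  mat 1 3 9 27 ∷ mat 1 3 9 27 ∷ mat 1 3 9 27 ∷ mat 1 3 9 27 ∷ mat 2 37 39 9 ∷ mat 1 37 52 70 ∷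
  mat 1 3 9 27 ∷ mat 2 74 17 35 ∷ mat 1 74 3 54 ∷ mat 1 3 9 27 ∷ mat 2 22 37 3 ∷ mat 1 6 37 50 ∷
  mat 22 2 37 3 ∷ mat 52 22 1 70 ∷ mat 17 1 52 9 ∷ mat 2 3 39 52 ∷ mat 1 17 52 9 ∷ mat 1 3 9 27 ∷
  mat 1 3 9 27 ∷ mat 2 3 74 52 ∷ mat 1 17 74 9 ∷ mat 1 6 78 50 ∷ mat 1 3 9 27 ∷ mat 2 22 68 3 ∷
  mat 17 1 74 9 ∷ mat 22 2 68 3 ∷ mat 17 68 2 35 ∷ mat 1 3 9 27 ∷ mat 2 22 3 37 ∷ mat 1 6 50 37 ∷
  mat 22 2 3 37 ∷ mat 52 22 70 1 ∷ mat 17 1 9 52 ∷ mat 2 3 52 39 ∷ mat 1 17 9 52 ∷ mat 1 3 9 27 ∷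
  mat 1 3 9 27 ∷ mat 1 3 9 27 ∷ mat 2 68 70 58 ∷ mat 1 3 9 27 ∷ mat 2 6 17 35 ∷ mat 1 52 3 18 ∷
  mat 68 2 70 58 ∷ mat 52 1 3 18 ∷ mat 70 52 2 39 ∷ mat 50 68 1 37 ∷ mat 68 2 6 58 ∷ mat 52 1 50 18 ∷
  mat 2 68 6 58 ∷ mat 1 3 22 27 ∷ mat 1 3 9 27 ∷ mat 1 52 50 18 ∷ mat 1 3 9 27 ∷ mat 2 6 18 35 ∷
  mat 1 3 9 27 ∷ mat 2 3 52 74 ∷ mat 1 17 9 74 ∷ mat 1 6 50 78 ∷ mat 1 3 9 27 ∷ mat 2 22 3 68 ∷
  mat 17 1 9 74 ∷ mat 22 2 3 68 ∷ mat 17 68 35 2 ∷ mat 52 70 2 74 ∷ mat 68 2 70 9 ∷ mat 52 1 3 35 ∷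
  mat 2 68 70 9 ∷ mat 1 3 9 58 ∷ mat 1 3 9 27 ∷ mat 1 52 3 35 ∷ mat 1 3 9 27 ∷ mat 2 6 17 54 ∷
  mat 2 6 18 54 ∷ mat 1 52 50 35 ∷ mat 1 3 9 27 ∷ mat 52 1 50 35 ∷ mat 50 68 1 78 ∷ mat 68 2 6 9 ∷
  mat 1 3 9 27 ∷ mat 2 68 6 9 ∷ mat 1 3 22 58 ∷ []

-- Search data for the caps disjoint from A₀ containing p₀: each leaf, with a
-- matrix fixing A₀ and moving the cap onto the representative B_r.
candidatesB : List ℕ
candidatesB = (63 ∷ 30 ∷ 57 ∷ 12 ∷ 66 ∷ 21 ∷ 48 ∷ 75 ∷ 28 ∷ 55 ∷ 10 ∷ 64 ∷ 19 ∷ 46 ∷ 73 ∷ 4 ∷ 31 ∷ 13 ∷ 40 ∷ 67 ∷ 49 ∷ 76 ∷ 7 ∷ 34 ∷ 61 ∷ 16 ∷ 43 ∷ 25 ∷ 79 ∷ [])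

classesB : List ((List ℕ × List ℕ) × Mat × Mat × ℕ)
classesB =
  (((79 ∷ 61 ∷ 40 ∷ 13 ∷ 73 ∷ 55 ∷ 57 ∷ 30 ∷ 63 ∷ 36 ∷ []) , []) , mat 1 3 9 27 , mat 1 3 9 27 , 0) ∷
  (((34 ∷ 7 ∷ 76 ∷ 67 ∷ 73 ∷ 64 ∷ 57 ∷ 30 ∷ 63 ∷ 36 ∷ []) , []) , mat 1 70 17 68 , mat 1 58 68 17 , 0) ∷
  (((43 ∷ 34 ∷ 40 ∷ 31 ∷ 73 ∷ 19 ∷ 57 ∷ 30 ∷ 63 ∷ 36 ∷ []) , []) , mat 1 3 9 27 , mat 1 3 9 27 , 1) ∷
  (((16 ∷ 7 ∷ 13 ∷ 4 ∷ 73 ∷ 46 ∷ 57 ∷ 30 ∷ 63 ∷ 36 ∷ []) , []) , mat 1 27 17 18 , mat 1 74 54 3 , 1) ∷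
  (((61 ∷ 7 ∷ 76 ∷ 49 ∷ 73 ∷ 55 ∷ 48 ∷ 30 ∷ 63 ∷ 36 ∷ []) , []) , mat 1 68 27 22 , mat 1 78 52 9 , 1) ∷
  (((79 ∷ 25 ∷ 67 ∷ 40 ∷ 73 ∷ 64 ∷ 48 ∷ 30 ∷ 63 ∷ 36 ∷ []) , []) , mat 1 9 68 54 , mat 1 70 3 54 , 1) ∷
  (((25 ∷ 7 ∷ 31 ∷ 4 ∷ 73 ∷ 19 ∷ 48 ∷ 30 ∷ 63 ∷ 36 ∷ []) , []) , mat 1 78 27 9 , mat 1 78 27 9 , 0) ∷
  (((43 ∷ 16 ∷ 49 ∷ 40 ∷ 73 ∷ 46 ∷ 48 ∷ 30 ∷ 63 ∷ 36 ∷ []) , []) , mat 1 58 18 78 , mat 1 52 18 50 , 0) ∷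
  (((61 ∷ 34 ∷ 67 ∷ 13 ∷ 64 ∷ 55 ∷ 66 ∷ 57 ∷ 63 ∷ 36 ∷ []) , []) , mat 1 6 37 50 , mat 1 6 50 78 , 1) ∷
  (((61 ∷ 34 ∷ 49 ∷ 31 ∷ 46 ∷ 19 ∷ 66 ∷ 57 ∷ 63 ∷ 36 ∷ []) , []) , mat 1 3 9 27 , mat 1 3 9 27 , 2) ∷
  (((25 ∷ 16 ∷ 67 ∷ 13 ∷ 46 ∷ 19 ∷ 66 ∷ 57 ∷ 63 ∷ 36 ∷ []) , []) , mat 1 6 37 50 , mat 1 6 50 78 , 2) ∷
  (((43 ∷ 34 ∷ 40 ∷ 13 ∷ 55 ∷ 28 ∷ 75 ∷ 57 ∷ 63 ∷ 36 ∷ []) , []) , mat 1 6 50 37 , mat 1 6 68 78 , 0) ∷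
  (((34 ∷ 7 ∷ 76 ∷ 49 ∷ 46 ∷ 28 ∷ 75 ∷ 57 ∷ 63 ∷ 36 ∷ []) , []) , mat 3 70 27 22 , mat 78 1 52 9 , 1) ∷
  (((34 ∷ 7 ∷ 13 ∷ 4 ∷ 64 ∷ 10 ∷ 75 ∷ 57 ∷ 63 ∷ 36 ∷ []) , []) , mat 1 27 17 18 , mat 1 74 54 3 , 0) ∷
  (((79 ∷ 25 ∷ 40 ∷ 13 ∷ 19 ∷ 10 ∷ 75 ∷ 57 ∷ 63 ∷ 36 ∷ []) , []) , mat 1 3 58 22 , mat 1 3 58 22 , 1) ∷
  (((61 ∷ 7 ∷ 13 ∷ 4 ∷ 73 ∷ 55 ∷ 66 ∷ 12 ∷ 63 ∷ 36 ∷ []) , []) , mat 1 78 9 27 , mat 1 78 9 27 , 0) ∷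
  (((43 ∷ 34 ∷ 67 ∷ 40 ∷ 73 ∷ 64 ∷ 66 ∷ 12 ∷ 63 ∷ 36 ∷ []) , []) , mat 1 22 50 35 , mat 1 70 68 17 , 0) ∷
  (((25 ∷ 7 ∷ 76 ∷ 67 ∷ 73 ∷ 19 ∷ 66 ∷ 12 ∷ 63 ∷ 36 ∷ []) , []) , mat 1 50 9 58 , mat 1 78 9 52 , 1) ∷
  (((79 ∷ 61 ∷ 49 ∷ 40 ∷ 73 ∷ 46 ∷ 66 ∷ 12 ∷ 63 ∷ 36 ∷ []) , []) , mat 1 22 50 35 , mat 1 70 68 17 , 1) ∷
  (((43 ∷ 16 ∷ 40 ∷ 13 ∷ 73 ∷ 55 ∷ 21 ∷ 12 ∷ 63 ∷ 36 ∷ []) , []) , mat 1 3 27 9 , mat 1 3 27 9 , 1) ∷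
  (((34 ∷ 7 ∷ 31 ∷ 4 ∷ 73 ∷ 64 ∷ 21 ∷ 12 ∷ 63 ∷ 36 ∷ []) , []) , mat 1 9 35 54 , mat 1 74 3 54 , 1) ∷
  (((79 ∷ 25 ∷ 40 ∷ 31 ∷ 73 ∷ 19 ∷ 21 ∷ 12 ∷ 63 ∷ 36 ∷ []) , []) , mat 1 3 27 9 , mat 1 3 27 9 , 0) ∷
  (((16 ∷ 7 ∷ 76 ∷ 49 ∷ 73 ∷ 46 ∷ 21 ∷ 12 ∷ 63 ∷ 36 ∷ []) , []) , mat 1 52 18 3 , mat 1 27 18 50 , 0) ∷
  (((61 ∷ 7 ∷ 76 ∷ 67 ∷ 55 ∷ 28 ∷ 75 ∷ 66 ∷ 63 ∷ 36 ∷ []) , []) , mat 1 39 17 37 , mat 1 58 68 78 , 0) ∷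
  (((43 ∷ 16 ∷ 67 ∷ 40 ∷ 46 ∷ 28 ∷ 75 ∷ 66 ∷ 63 ∷ 36 ∷ []) , []) , mat 3 9 70 54 , mat 70 1 3 54 , 1) ∷
  (((79 ∷ 61 ∷ 67 ∷ 40 ∷ 64 ∷ 10 ∷ 75 ∷ 66 ∷ 63 ∷ 36 ∷ []) , []) , mat 1 27 17 37 , mat 1 52 35 3 , 0) ∷
  (((61 ∷ 7 ∷ 31 ∷ 4 ∷ 19 ∷ 10 ∷ 75 ∷ 66 ∷ 63 ∷ 36 ∷ []) , []) , mat 1 54 52 58 , mat 1 35 74 6 , 1) ∷
  (((61 ∷ 34 ∷ 49 ∷ 31 ∷ 64 ∷ 55 ∷ 48 ∷ 21 ∷ 63 ∷ 36 ∷ []) , []) , mat 1 6 37 68 , mat 1 6 78 50 , 2) ∷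
  (((25 ∷ 16 ∷ 67 ∷ 13 ∷ 64 ∷ 55 ∷ 48 ∷ 21 ∷ 63 ∷ 36 ∷ []) , []) , mat 1 3 27 9 , mat 1 3 27 9 , 2) ∷
  (((25 ∷ 16 ∷ 49 ∷ 31 ∷ 46 ∷ 19 ∷ 48 ∷ 21 ∷ 63 ∷ 36 ∷ []) , []) , mat 1 6 37 68 , mat 1 6 78 50 , 1) ∷
  (((79 ∷ 61 ∷ 40 ∷ 31 ∷ 55 ∷ 28 ∷ 75 ∷ 21 ∷ 63 ∷ 36 ∷ []) , []) , mat 1 3 22 58 , mat 1 3 22 58 , 1) ∷
  (((16 ∷ 7 ∷ 31 ∷ 4 ∷ 46 ∷ 28 ∷ 75 ∷ 21 ∷ 63 ∷ 36 ∷ []) , []) , mat 1 9 35 54 , mat 1 74 3 54 , 0) ∷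
  (((16 ∷ 7 ∷ 76 ∷ 67 ∷ 64 ∷ 10 ∷ 75 ∷ 21 ∷ 63 ∷ 36 ∷ []) , []) , mat 3 52 9 58 , mat 78 1 9 52 , 1) ∷
  (((43 ∷ 16 ∷ 40 ∷ 31 ∷ 19 ∷ 10 ∷ 75 ∷ 21 ∷ 63 ∷ 36 ∷ []) , []) , mat 1 6 50 78 , mat 1 6 37 50 , 0) ∷
  (((25 ∷ 7 ∷ 13 ∷ 4 ∷ 55 ∷ 28 ∷ 75 ∷ 48 ∷ 63 ∷ 36 ∷ []) , []) , mat 1 18 70 22 , mat 1 35 6 74 , 1) ∷
  (((79 ∷ 25 ∷ 49 ∷ 40 ∷ 46 ∷ 28 ∷ 75 ∷ 48 ∷ 63 ∷ 36 ∷ []) , []) , mat 1 9 35 37 , mat 1 52 3 35 , 0) ∷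
  (((43 ∷ 34 ∷ 49 ∷ 40 ∷ 64 ∷ 10 ∷ 75 ∷ 48 ∷ 63 ∷ 36 ∷ []) , []) , mat 3 22 52 35 , mat 70 1 68 17 , 1) ∷
  (((25 ∷ 7 ∷ 76 ∷ 49 ∷ 19 ∷ 10 ∷ 75 ∷ 48 ∷ 63 ∷ 36 ∷ []) , []) , mat 1 39 17 3 , mat 1 27 37 50 , 0) ∷
  (((76 ∷ 67 ∷ 13 ∷ 73 ∷ 55 ∷ 28 ∷ 75 ∷ 57 ∷ 30 ∷ 36 ∷ []) , []) , mat 1 6 68 78 , mat 1 6 50 37 , 1) ∷
  (((43 ∷ 16 ∷ 34 ∷ 73 ∷ 46 ∷ 28 ∷ 75 ∷ 57 ∷ 30 ∷ 36 ∷ []) , []) , mat 1 70 3 54 , mat 1 9 68 54 , 0) ∷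
  (((79 ∷ 61 ∷ 34 ∷ 73 ∷ 64 ∷ 10 ∷ 75 ∷ 57 ∷ 30 ∷ 36 ∷ []) , []) , mat 1 54 39 6 , mat 1 54 39 6 , 1) ∷
  (((13 ∷ 31 ∷ 4 ∷ 73 ∷ 19 ∷ 10 ∷ 75 ∷ 57 ∷ 30 ∷ 36 ∷ []) , []) , mat 1 54 39 6 , mat 1 54 39 6 , 0) ∷
  (((79 ∷ 25 ∷ 61 ∷ 73 ∷ 55 ∷ 28 ∷ 75 ∷ 48 ∷ 30 ∷ 36 ∷ []) , []) , mat 1 18 6 39 , mat 1 18 6 39 , 0) ∷
  (((49 ∷ 31 ∷ 4 ∷ 73 ∷ 46 ∷ 28 ∷ 75 ∷ 48 ∷ 30 ∷ 36 ∷ []) , []) , mat 1 17 6 52 , mat 1 18 22 39 , 1) ∷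
  (((76 ∷ 49 ∷ 67 ∷ 73 ∷ 64 ∷ 10 ∷ 75 ∷ 48 ∷ 30 ∷ 36 ∷ []) , []) , mat 1 58 17 68 , mat 1 52 35 50 , 0) ∷
  (((25 ∷ 43 ∷ 16 ∷ 73 ∷ 19 ∷ 10 ∷ 75 ∷ 48 ∷ 30 ∷ 36 ∷ []) , []) , mat 1 39 17 3 , mat 1 27 37 50 , 1) ∷
  (((43 ∷ 16 ∷ 34 ∷ 13 ∷ 31 ∷ 4 ∷ 75 ∷ 21 ∷ 57 ∷ 36 ∷ []) , []) , mat 1 9 37 68 , mat 1 39 3 17 , 1) ∷
  (((79 ∷ 61 ∷ 34 ∷ 76 ∷ 49 ∷ 31 ∷ 75 ∷ 21 ∷ 57 ∷ 36 ∷ []) , []) , mat 1 3 22 27 , mat 1 3 22 27 , 2) ∷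
  (((79 ∷ 25 ∷ 16 ∷ 76 ∷ 67 ∷ 13 ∷ 75 ∷ 21 ∷ 57 ∷ 36 ∷ []) , []) , mat 1 3 58 9 , mat 1 3 27 22 , 2) ∷
  (((43 ∷ 61 ∷ 34 ∷ 73 ∷ 55 ∷ 28 ∷ 75 ∷ 66 ∷ 12 ∷ 36 ∷ []) , []) , mat 1 22 35 50 , mat 1 52 50 35 , 1) ∷
  (((76 ∷ 49 ∷ 67 ∷ 73 ∷ 46 ∷ 28 ∷ 75 ∷ 66 ∷ 12 ∷ 36 ∷ []) , []) , mat 1 22 35 50 , mat 1 52 50 35 , 0) ∷
  (((67 ∷ 13 ∷ 4 ∷ 73 ∷ 64 ∷ 10 ∷ 75 ∷ 66 ∷ 12 ∷ 36 ∷ []) , []) , mat 1 35 6 70 , mat 1 18 39 22 , 1) ∷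
  (((79 ∷ 25 ∷ 61 ∷ 73 ∷ 19 ∷ 10 ∷ 75 ∷ 66 ∷ 12 ∷ 36 ∷ []) , []) , mat 1 54 6 39 , mat 1 18 39 6 , 0) ∷
  (((13 ∷ 31 ∷ 4 ∷ 73 ∷ 55 ∷ 28 ∷ 75 ∷ 21 ∷ 12 ∷ 36 ∷ []) , []) , mat 1 18 39 6 , mat 1 54 6 39 , 0) ∷
  (((79 ∷ 25 ∷ 16 ∷ 73 ∷ 46 ∷ 28 ∷ 75 ∷ 21 ∷ 12 ∷ 36 ∷ []) , []) , mat 1 18 39 6 , mat 1 54 6 39 , 1) ∷
  (((43 ∷ 16 ∷ 34 ∷ 73 ∷ 64 ∷ 10 ∷ 75 ∷ 21 ∷ 12 ∷ 36 ∷ []) , []) , mat 1 52 3 18 , mat 1 9 54 68 , 0) ∷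
  (((76 ∷ 49 ∷ 31 ∷ 73 ∷ 19 ∷ 10 ∷ 75 ∷ 21 ∷ 12 ∷ 36 ∷ []) , []) , mat 1 6 50 78 , mat 1 6 37 50 , 1) ∷
  (((43 ∷ 61 ∷ 34 ∷ 49 ∷ 31 ∷ 4 ∷ 75 ∷ 48 ∷ 66 ∷ 36 ∷ []) , []) , mat 1 18 6 39 , mat 1 18 6 39 , 2) ∷
  (((25 ∷ 43 ∷ 16 ∷ 67 ∷ 13 ∷ 4 ∷ 75 ∷ 48 ∷ 66 ∷ 36 ∷ []) , []) , mat 1 9 37 35 , mat 1 70 3 17 , 2) ∷
  (((79 ∷ 25 ∷ 61 ∷ 76 ∷ 49 ∷ 67 ∷ 75 ∷ 48 ∷ 66 ∷ 36 ∷ []) , []) , mat 1 9 37 35 , mat 1 70 3 17 , 1) ∷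
  (((79 ∷ 25 ∷ 61 ∷ 13 ∷ 31 ∷ 4 ∷ 73 ∷ 19 ∷ 55 ∷ 36 ∷ []) , []) , mat 3 9 39 70 , mat 39 1 3 17 , 1) ∷
  (((43 ∷ 61 ∷ 34 ∷ 76 ∷ 49 ∷ 31 ∷ 73 ∷ 19 ∷ 55 ∷ 36 ∷ []) , []) , mat 1 6 50 78 , mat 1 6 37 50 , 2) ∷
  (((25 ∷ 43 ∷ 16 ∷ 76 ∷ 67 ∷ 13 ∷ 73 ∷ 19 ∷ 55 ∷ 36 ∷ []) , []) , mat 1 6 68 78 , mat 1 6 50 37 , 2) ∷
  (((79 ∷ 61 ∷ 34 ∷ 49 ∷ 31 ∷ 4 ∷ 73 ∷ 46 ∷ 64 ∷ 36 ∷ []) , []) , mat 1 9 35 54 , mat 1 74 3 54 , 2) ∷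
  (((79 ∷ 25 ∷ 16 ∷ 67 ∷ 13 ∷ 4 ∷ 73 ∷ 46 ∷ 64 ∷ 36 ∷ []) , []) , mat 1 9 68 54 , mat 1 70 3 54 , 2) ∷
  (((43 ∷ 16 ∷ 34 ∷ 76 ∷ 49 ∷ 67 ∷ 73 ∷ 46 ∷ 64 ∷ 36 ∷ []) , []) , mat 3 9 39 35 , mat 70 1 3 17 , 1) ∷ []

-- The three representatives B₀, B₁, B₂, with the completions of {A₀, B_r}
-- (search candidates, leaves, completions) and, shared by all these
-- completions {C, D}, the same data for the completions of {C, D}.
B₀ : List ℕ
B₀ = (36 ∷ 63 ∷ 45 ∷ 72 ∷ 30 ∷ 57 ∷ 33 ∷ 60 ∷ 55 ∷ 73 ∷ 13 ∷ 40 ∷ 61 ∷ 79 ∷ 29 ∷ 38 ∷ 32 ∷ 41 ∷ 26 ∷ 80 ∷ [])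

candidatesAB₀ : List ℕ
candidatesAB₀ = (12 ∷ 66 ∷ 21 ∷ 48 ∷ 75 ∷ 28 ∷ 10 ∷ 64 ∷ 19 ∷ 46 ∷ 4 ∷ 31 ∷ 67 ∷ 49 ∷ 76 ∷ 7 ∷ 34 ∷ 16 ∷ 43 ∷ 25 ∷ [])

leavesAB₀ : List (List ℕ × List ℕ)
leavesAB₀ =
  ((25 ∷ 43 ∷ 16 ∷ 34 ∷ 67 ∷ 64 ∷ 48 ∷ 21 ∷ 66 ∷ 12 ∷ []) , []) ∷
  ((25 ∷ 76 ∷ 49 ∷ 67 ∷ 31 ∷ 19 ∷ 48 ∷ 21 ∷ 66 ∷ 12 ∷ []) , []) ∷
  ((16 ∷ 67 ∷ 46 ∷ 64 ∷ 10 ∷ 28 ∷ 75 ∷ 21 ∷ 66 ∷ 12 ∷ []) , []) ∷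
  ((7 ∷ 76 ∷ 67 ∷ 31 ∷ 4 ∷ 28 ∷ 75 ∷ 21 ∷ 66 ∷ 12 ∷ []) , []) ∷
  ((25 ∷ 49 ∷ 46 ∷ 19 ∷ 10 ∷ 28 ∷ 75 ∷ 48 ∷ 66 ∷ 12 ∷ []) , []) ∷
  ((25 ∷ 43 ∷ 34 ∷ 7 ∷ 4 ∷ 28 ∷ 75 ∷ 48 ∷ 66 ∷ 12 ∷ []) , []) ∷
  ((16 ∷ 76 ∷ 49 ∷ 67 ∷ 31 ∷ 46 ∷ 19 ∷ 64 ∷ 10 ∷ 21 ∷ []) , []) ∷
  ((43 ∷ 16 ∷ 34 ∷ 7 ∷ 76 ∷ 67 ∷ 31 ∷ 4 ∷ 64 ∷ 21 ∷ []) , []) ∷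
  ((25 ∷ 43 ∷ 16 ∷ 34 ∷ 49 ∷ 46 ∷ 19 ∷ 64 ∷ 10 ∷ 48 ∷ []) , []) ∷
  ((25 ∷ 43 ∷ 34 ∷ 7 ∷ 76 ∷ 49 ∷ 31 ∷ 4 ∷ 19 ∷ 48 ∷ []) , []) ∷
  ((43 ∷ 16 ∷ 34 ∷ 7 ∷ 4 ∷ 46 ∷ 64 ∷ 10 ∷ 28 ∷ 75 ∷ []) , []) ∷
  ((7 ∷ 76 ∷ 49 ∷ 31 ∷ 4 ∷ 46 ∷ 19 ∷ 10 ∷ 28 ∷ 75 ∷ []) , []) ∷ []

completionsAB₀ : List (List ℕ × List ℕ)
completionsAB₀ =
  ((25 ∷ 43 ∷ 16 ∷ 34 ∷ 67 ∷ 64 ∷ 48 ∷ 21 ∷ 66 ∷ 12 ∷ 14 ∷ 77 ∷ 23 ∷ 59 ∷ 53 ∷ 47 ∷ 69 ∷ 15 ∷ 51 ∷ 24 ∷ []) , (4 ∷ 5 ∷ 7 ∷ 8 ∷ 10 ∷ 11 ∷ 19 ∷ 20 ∷ 28 ∷ 31 ∷ 42 ∷ 44 ∷ 46 ∷ 49 ∷ 56 ∷ 62 ∷ 65 ∷ 71 ∷ 75 ∷ 76 ∷ [])) ∷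
  ((25 ∷ 76 ∷ 49 ∷ 67 ∷ 31 ∷ 19 ∷ 48 ∷ 21 ∷ 66 ∷ 12 ∷ 14 ∷ 44 ∷ 71 ∷ 53 ∷ 62 ∷ 11 ∷ 69 ∷ 15 ∷ 51 ∷ 24 ∷ []) , (4 ∷ 5 ∷ 7 ∷ 8 ∷ 10 ∷ 16 ∷ 20 ∷ 23 ∷ 28 ∷ 34 ∷ 42 ∷ 43 ∷ 46 ∷ 47 ∷ 56 ∷ 59 ∷ 64 ∷ 65 ∷ 75 ∷ 77 ∷ [])) ∷
  ((16 ∷ 67 ∷ 46 ∷ 64 ∷ 10 ∷ 28 ∷ 75 ∷ 21 ∷ 66 ∷ 12 ∷ 23 ∷ 53 ∷ 65 ∷ 47 ∷ 20 ∷ 56 ∷ 42 ∷ 15 ∷ 51 ∷ 24 ∷ []) , (4 ∷ 5 ∷ 7 ∷ 8 ∷ 11 ∷ 14 ∷ 19 ∷ 25 ∷ 31 ∷ 34 ∷ 43 ∷ 44 ∷ 48 ∷ 49 ∷ 59 ∷ 62 ∷ 69 ∷ 71 ∷ 76 ∷ 77 ∷ [])) ∷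
  ((7 ∷ 76 ∷ 67 ∷ 31 ∷ 4 ∷ 28 ∷ 75 ∷ 21 ∷ 66 ∷ 12 ∷ 5 ∷ 44 ∷ 53 ∷ 62 ∷ 8 ∷ 56 ∷ 42 ∷ 15 ∷ 51 ∷ 24 ∷ []) , (10 ∷ 11 ∷ 14 ∷ 16 ∷ 19 ∷ 20 ∷ 23 ∷ 25 ∷ 34 ∷ 43 ∷ 46 ∷ 47 ∷ 48 ∷ 49 ∷ 59 ∷ 64 ∷ 65 ∷ 69 ∷ 71 ∷ 77 ∷ [])) ∷
  ((25 ∷ 49 ∷ 46 ∷ 19 ∷ 10 ∷ 28 ∷ 75 ∷ 48 ∷ 66 ∷ 12 ∷ 14 ∷ 71 ∷ 65 ∷ 11 ∷ 20 ∷ 56 ∷ 42 ∷ 69 ∷ 51 ∷ 24 ∷ []) , (4 ∷ 5 ∷ 7 ∷ 8 ∷ 15 ∷ 16 ∷ 21 ∷ 23 ∷ 31 ∷ 34 ∷ 43 ∷ 44 ∷ 47 ∷ 53 ∷ 59 ∷ 62 ∷ 64 ∷ 67 ∷ 76 ∷ 77 ∷ [])) ∷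
  ((25 ∷ 43 ∷ 34 ∷ 7 ∷ 4 ∷ 28 ∷ 75 ∷ 48 ∷ 66 ∷ 12 ∷ 14 ∷ 77 ∷ 59 ∷ 5 ∷ 8 ∷ 56 ∷ 42 ∷ 69 ∷ 51 ∷ 24 ∷ []) , (10 ∷ 11 ∷ 15 ∷ 16 ∷ 19 ∷ 20 ∷ 21 ∷ 23 ∷ 31 ∷ 44 ∷ 46 ∷ 47 ∷ 49 ∷ 53 ∷ 62 ∷ 64 ∷ 65 ∷ 67 ∷ 71 ∷ 76 ∷ [])) ∷ []

candidatesCD₀ : List ℕ
candidatesCD₀ = (27 ∷ 9 ∷ 36 ∷ 63 ∷ 3 ∷ 30 ∷ 57 ∷ 39 ∷ 1 ∷ 55 ∷ 37 ∷ 73 ∷ 58 ∷ 13 ∷ 40 ∷ 22 ∷ 61 ∷ 70 ∷ 52 ∷ 79 ∷ [])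

leavesCD₀ : List (List ℕ × List ℕ)
leavesCD₀ =
  ((52 ∷ 70 ∷ 22 ∷ 58 ∷ 37 ∷ 1 ∷ 39 ∷ 3 ∷ 9 ∷ 27 ∷ []) , []) ∷
  ((52 ∷ 61 ∷ 40 ∷ 58 ∷ 73 ∷ 37 ∷ 39 ∷ 57 ∷ 9 ∷ 27 ∷ []) , []) ∷
  ((79 ∷ 70 ∷ 22 ∷ 58 ∷ 37 ∷ 55 ∷ 39 ∷ 30 ∷ 36 ∷ 27 ∷ []) , []) ∷
  ((70 ∷ 61 ∷ 22 ∷ 40 ∷ 73 ∷ 55 ∷ 39 ∷ 57 ∷ 36 ∷ 27 ∷ []) , []) ∷
  ((70 ∷ 61 ∷ 22 ∷ 13 ∷ 73 ∷ 1 ∷ 39 ∷ 3 ∷ 63 ∷ 27 ∷ []) , []) ∷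
  ((79 ∷ 61 ∷ 13 ∷ 58 ∷ 73 ∷ 37 ∷ 39 ∷ 30 ∷ 63 ∷ 27 ∷ []) , []) ∷
  ((52 ∷ 70 ∷ 22 ∷ 40 ∷ 55 ∷ 1 ∷ 57 ∷ 3 ∷ 36 ∷ 9 ∷ []) , []) ∷
  ((79 ∷ 52 ∷ 40 ∷ 58 ∷ 37 ∷ 55 ∷ 57 ∷ 30 ∷ 36 ∷ 9 ∷ []) , []) ∷
  ((79 ∷ 52 ∷ 13 ∷ 58 ∷ 37 ∷ 1 ∷ 30 ∷ 3 ∷ 63 ∷ 9 ∷ []) , []) ∷
  ((52 ∷ 61 ∷ 40 ∷ 13 ∷ 73 ∷ 1 ∷ 57 ∷ 3 ∷ 63 ∷ 9 ∷ []) , []) ∷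
  ((79 ∷ 70 ∷ 22 ∷ 13 ∷ 55 ∷ 1 ∷ 30 ∷ 3 ∷ 63 ∷ 36 ∷ []) , []) ∷
  ((79 ∷ 61 ∷ 40 ∷ 13 ∷ 73 ∷ 55 ∷ 57 ∷ 30 ∷ 63 ∷ 36 ∷ []) , []) ∷ []

completionsCD₀ : List (List ℕ × List ℕ)
completionsCD₀ =
  ((52 ∷ 70 ∷ 22 ∷ 58 ∷ 37 ∷ 1 ∷ 39 ∷ 3 ∷ 9 ∷ 27 ∷ 68 ∷ 50 ∷ 17 ∷ 35 ∷ 74 ∷ 2 ∷ 78 ∷ 6 ∷ 18 ∷ 54 ∷ []) , (13 ∷ 26 ∷ 29 ∷ 30 ∷ 32 ∷ 33 ∷ 36 ∷ 38 ∷ 40 ∷ 41 ∷ 45 ∷ 55 ∷ 57 ∷ 60 ∷ 61 ∷ 63 ∷ 72 ∷ 73 ∷ 79 ∷ 80 ∷ [])) ∷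
  ((52 ∷ 61 ∷ 40 ∷ 58 ∷ 73 ∷ 37 ∷ 39 ∷ 57 ∷ 9 ∷ 27 ∷ 68 ∷ 32 ∷ 80 ∷ 35 ∷ 38 ∷ 74 ∷ 78 ∷ 33 ∷ 18 ∷ 54 ∷ []) , (1 ∷ 2 ∷ 3 ∷ 6 ∷ 13 ∷ 17 ∷ 22 ∷ 26 ∷ 29 ∷ 30 ∷ 36 ∷ 41 ∷ 45 ∷ 50 ∷ 55 ∷ 60 ∷ 63 ∷ 70 ∷ 72 ∷ 79 ∷ [])) ∷
  ((79 ∷ 70 ∷ 22 ∷ 58 ∷ 37 ∷ 55 ∷ 39 ∷ 30 ∷ 36 ∷ 27 ∷ 41 ∷ 50 ∷ 17 ∷ 35 ∷ 74 ∷ 29 ∷ 78 ∷ 60 ∷ 72 ∷ 54 ∷ []) , (1 ∷ 2 ∷ 3 ∷ 6 ∷ 9 ∷ 13 ∷ 18 ∷ 26 ∷ 32 ∷ 33 ∷ 38 ∷ 40 ∷ 45 ∷ 52 ∷ 57 ∷ 61 ∷ 63 ∷ 68 ∷ 73 ∷ 80 ∷ [])) ∷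
  ((70 ∷ 61 ∷ 22 ∷ 40 ∷ 73 ∷ 55 ∷ 39 ∷ 57 ∷ 36 ∷ 27 ∷ 50 ∷ 32 ∷ 17 ∷ 80 ∷ 38 ∷ 29 ∷ 78 ∷ 33 ∷ 72 ∷ 54 ∷ []) , (1 ∷ 2 ∷ 3 ∷ 6 ∷ 9 ∷ 13 ∷ 18 ∷ 26 ∷ 30 ∷ 35 ∷ 37 ∷ 41 ∷ 45 ∷ 52 ∷ 58 ∷ 60 ∷ 63 ∷ 68 ∷ 74 ∷ 79 ∷ [])) ∷
  ((70 ∷ 61 ∷ 22 ∷ 13 ∷ 73 ∷ 1 ∷ 39 ∷ 3 ∷ 63 ∷ 27 ∷ 50 ∷ 32 ∷ 17 ∷ 26 ∷ 38 ∷ 2 ∷ 78 ∷ 6 ∷ 45 ∷ 54 ∷ []) , (9 ∷ 18 ∷ 29 ∷ 30 ∷ 33 ∷ 35 ∷ 36 ∷ 37 ∷ 40 ∷ 41 ∷ 52 ∷ 55 ∷ 57 ∷ 58 ∷ 60 ∷ 68 ∷ 72 ∷ 74 ∷ 79 ∷ 80 ∷ [])) ∷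
  ((79 ∷ 61 ∷ 13 ∷ 58 ∷ 73 ∷ 37 ∷ 39 ∷ 30 ∷ 63 ∷ 27 ∷ 41 ∷ 32 ∷ 26 ∷ 35 ∷ 38 ∷ 74 ∷ 78 ∷ 60 ∷ 45 ∷ 54 ∷ []) , (1 ∷ 2 ∷ 3 ∷ 6 ∷ 9 ∷ 17 ∷ 18 ∷ 22 ∷ 29 ∷ 33 ∷ 36 ∷ 40 ∷ 50 ∷ 52 ∷ 55 ∷ 57 ∷ 68 ∷ 70 ∷ 72 ∷ 80 ∷ [])) ∷ []

B₁ : List ℕ
B₁ = (36 ∷ 63 ∷ 45 ∷ 72 ∷ 30 ∷ 57 ∷ 33 ∷ 60 ∷ 19 ∷ 73 ∷ 31 ∷ 40 ∷ 34 ∷ 43 ∷ 11 ∷ 38 ∷ 59 ∷ 77 ∷ 62 ∷ 80 ∷ [])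

candidatesAB₁ : List ℕ
candidatesAB₁ = (12 ∷ 66 ∷ 21 ∷ 48 ∷ 75 ∷ 28 ∷ 55 ∷ 10 ∷ 64 ∷ 46 ∷ 4 ∷ 13 ∷ 67 ∷ 49 ∷ 76 ∷ 7 ∷ 61 ∷ 16 ∷ 25 ∷ 79 ∷ [])

leavesAB₁ : List (List ℕ × List ℕ)
leavesAB₁ =
  ((79 ∷ 25 ∷ 16 ∷ 61 ∷ 49 ∷ 46 ∷ 48 ∷ 21 ∷ 66 ∷ 12 ∷ []) , []) ∷
  ((16 ∷ 67 ∷ 46 ∷ 64 ∷ 10 ∷ 28 ∷ 75 ∷ 21 ∷ 66 ∷ 12 ∷ []) , []) ∷
  ((79 ∷ 25 ∷ 61 ∷ 7 ∷ 76 ∷ 49 ∷ 13 ∷ 4 ∷ 55 ∷ 48 ∷ []) , []) ∷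
  ((7 ∷ 76 ∷ 67 ∷ 13 ∷ 4 ∷ 64 ∷ 10 ∷ 55 ∷ 28 ∷ 75 ∷ []) , []) ∷ []

completionsAB₁ : List (List ℕ × List ℕ)
completionsAB₁ =
  ((79 ∷ 25 ∷ 16 ∷ 61 ∷ 49 ∷ 46 ∷ 48 ∷ 21 ∷ 66 ∷ 12 ∷ 41 ∷ 14 ∷ 23 ∷ 32 ∷ 71 ∷ 65 ∷ 69 ∷ 15 ∷ 51 ∷ 24 ∷ []) , (4 ∷ 5 ∷ 7 ∷ 8 ∷ 10 ∷ 13 ∷ 20 ∷ 26 ∷ 28 ∷ 29 ∷ 42 ∷ 44 ∷ 47 ∷ 53 ∷ 55 ∷ 56 ∷ 64 ∷ 67 ∷ 75 ∷ 76 ∷ [])) ∷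
  ((16 ∷ 67 ∷ 46 ∷ 64 ∷ 10 ∷ 28 ∷ 75 ∷ 21 ∷ 66 ∷ 12 ∷ 23 ∷ 53 ∷ 65 ∷ 47 ∷ 20 ∷ 56 ∷ 42 ∷ 15 ∷ 51 ∷ 24 ∷ []) , (4 ∷ 5 ∷ 7 ∷ 8 ∷ 13 ∷ 14 ∷ 25 ∷ 26 ∷ 29 ∷ 32 ∷ 41 ∷ 44 ∷ 48 ∷ 49 ∷ 55 ∷ 61 ∷ 69 ∷ 71 ∷ 76 ∷ 79 ∷ [])) ∷ []

candidatesCD₁ : List ℕ
candidatesCD₁ = (27 ∷ 9 ∷ 36 ∷ 63 ∷ 3 ∷ 30 ∷ 57 ∷ 39 ∷ 1 ∷ 37 ∷ 19 ∷ 73 ∷ 31 ∷ 58 ∷ 40 ∷ 22 ∷ 34 ∷ 43 ∷ 70 ∷ 52 ∷ [])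

leavesCD₁ : List (List ℕ × List ℕ)
leavesCD₁ =
  ((52 ∷ 70 ∷ 22 ∷ 58 ∷ 37 ∷ 1 ∷ 39 ∷ 3 ∷ 9 ∷ 27 ∷ []) , []) ∷
  ((52 ∷ 34 ∷ 40 ∷ 58 ∷ 19 ∷ 37 ∷ 39 ∷ 30 ∷ 36 ∷ 27 ∷ []) , []) ∷
  ((70 ∷ 43 ∷ 22 ∷ 31 ∷ 73 ∷ 1 ∷ 57 ∷ 3 ∷ 63 ∷ 9 ∷ []) , []) ∷
  ((43 ∷ 34 ∷ 40 ∷ 31 ∷ 73 ∷ 19 ∷ 57 ∷ 30 ∷ 63 ∷ 36 ∷ []) , []) ∷ []

completionsCD₁ : List (List ℕ × List ℕ)
completionsCD₁ =
  ((52 ∷ 70 ∷ 22 ∷ 58 ∷ 37 ∷ 1 ∷ 39 ∷ 3 ∷ 9 ∷ 27 ∷ 68 ∷ 50 ∷ 17 ∷ 35 ∷ 74 ∷ 2 ∷ 78 ∷ 6 ∷ 18 ∷ 54 ∷ []) , (11 ∷ 19 ∷ 30 ∷ 31 ∷ 33 ∷ 34 ∷ 36 ∷ 38 ∷ 40 ∷ 43 ∷ 45 ∷ 57 ∷ 59 ∷ 60 ∷ 62 ∷ 63 ∷ 72 ∷ 73 ∷ 77 ∷ 80 ∷ [])) ∷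
  ((52 ∷ 34 ∷ 40 ∷ 58 ∷ 19 ∷ 37 ∷ 39 ∷ 30 ∷ 36 ∷ 27 ∷ 68 ∷ 59 ∷ 80 ∷ 35 ∷ 11 ∷ 74 ∷ 78 ∷ 60 ∷ 72 ∷ 54 ∷ []) , (1 ∷ 2 ∷ 3 ∷ 6 ∷ 9 ∷ 17 ∷ 18 ∷ 22 ∷ 31 ∷ 33 ∷ 38 ∷ 43 ∷ 45 ∷ 50 ∷ 57 ∷ 62 ∷ 63 ∷ 70 ∷ 73 ∷ 77 ∷ [])) ∷ []

B₂ : List ℕ
B₂ = (36 ∷ 63 ∷ 45 ∷ 72 ∷ 57 ∷ 66 ∷ 33 ∷ 51 ∷ 19 ∷ 46 ∷ 31 ∷ 49 ∷ 34 ∷ 61 ∷ 11 ∷ 65 ∷ 32 ∷ 59 ∷ 62 ∷ 71 ∷ [])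

candidatesAB₂ : List ℕ
candidatesAB₂ = (30 ∷ 12 ∷ 21 ∷ 48 ∷ 75 ∷ 28 ∷ 55 ∷ 10 ∷ 64 ∷ 73 ∷ 4 ∷ 13 ∷ 40 ∷ 67 ∷ 76 ∷ 7 ∷ 16 ∷ 43 ∷ 25 ∷ 79 ∷ [])

leavesAB₂ : List (List ℕ × List ℕ)
leavesAB₂ =
  ((79 ∷ 25 ∷ 43 ∷ 16 ∷ 40 ∷ 73 ∷ 48 ∷ 21 ∷ 12 ∷ 30 ∷ []) , []) ∷
  ((7 ∷ 76 ∷ 67 ∷ 13 ∷ 4 ∷ 64 ∷ 10 ∷ 55 ∷ 28 ∷ 75 ∷ []) , []) ∷ []

completionsAB₂ : List (List ℕ × List ℕ)
completionsAB₂ =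
  ((79 ∷ 25 ∷ 43 ∷ 16 ∷ 40 ∷ 73 ∷ 48 ∷ 21 ∷ 12 ∷ 30 ∷ 41 ∷ 14 ∷ 77 ∷ 23 ∷ 80 ∷ 38 ∷ 69 ∷ 15 ∷ 24 ∷ 60 ∷ []) , (4 ∷ 5 ∷ 7 ∷ 8 ∷ 10 ∷ 13 ∷ 20 ∷ 26 ∷ 28 ∷ 29 ∷ 42 ∷ 44 ∷ 47 ∷ 53 ∷ 55 ∷ 56 ∷ 64 ∷ 67 ∷ 75 ∷ 76 ∷ [])) ∷ []

candidatesCD₂ : List ℕ
candidatesCD₂ = (27 ∷ 9 ∷ 36 ∷ 63 ∷ 3 ∷ 57 ∷ 39 ∷ 66 ∷ 1 ∷ 37 ∷ 19 ∷ 46 ∷ 31 ∷ 58 ∷ 22 ∷ 49 ∷ 34 ∷ 61 ∷ 70 ∷ 52 ∷ [])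

leavesCD₂ : List (List ℕ × List ℕ)
leavesCD₂ =
  ((52 ∷ 70 ∷ 22 ∷ 58 ∷ 37 ∷ 1 ∷ 39 ∷ 3 ∷ 9 ∷ 27 ∷ []) , []) ∷
  ((61 ∷ 34 ∷ 49 ∷ 31 ∷ 46 ∷ 19 ∷ 66 ∷ 57 ∷ 63 ∷ 36 ∷ []) , []) ∷ []

completionsCD₂ : List (List ℕ × List ℕ)
completionsCD₂ =
  ((52 ∷ 70 ∷ 22 ∷ 58 ∷ 37 ∷ 1 ∷ 39 ∷ 3 ∷ 9 ∷ 27 ∷ 68 ∷ 50 ∷ 17 ∷ 35 ∷ 74 ∷ 2 ∷ 78 ∷ 6 ∷ 18 ∷ 54 ∷ []) , (11 ∷ 19 ∷ 31 ∷ 32 ∷ 33 ∷ 34 ∷ 36 ∷ 45 ∷ 46 ∷ 49 ∷ 51 ∷ 57 ∷ 59 ∷ 61 ∷ 62 ∷ 63 ∷ 65 ∷ 66 ∷ 71 ∷ 72 ∷ [])) ∷ []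

representative : ℕ → List ℕ
representative 0 = B₀
representative 1 = B₁
representative _ = B₂

open Normalisation A₀ refl

transfer-representative : ∀ r C D → CountTransfer (codeSet A₀) (codeSet (representative r)) C D
transfer-representative 0 =
  transfer-certified A₀ B₀ candidatesAB₀ leavesAB₀ completionsAB₀ candidatesCD₀ leavesCD₀ completionsCD₀
    refl refl refl refl refl
transfer-representative 1 =
  transfer-certified A₀ B₁ candidatesAB₁ leavesAB₁ completionsAB₁ candidatesCD₁ leavesCD₁ completionsCD₁
    refl refl refl refl refl
transfer-representative (suc (suc _)) =
  transfer-certified A₀ B₂ candidatesAB₂ leavesAB₂ completionsAB₂ candidatesCD₂ leavesCD₂ completionsCD₂
    refl refl refl refl refl

count-transfer : ∀ A B C D → CountTransfer A B C D
count-transfer A B C D = basis-e₁ A B C D []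
  where
  pair-normal : ∀ A B C D → A ≐ codeSet A₀ → Contains B (p₀ ∷ []) → CountTransfer A B C D
  pair-normal = classify-pair A₀ (p₀ ∷ []) 9 candidatesB classesB representative
    refl refl refl refl refl transfer-representative
  A-normal : ∀ A B C D → A ≐ codeSet A₀ → CountTransfer A B C D
  A-normal = move-into-B A₀ p₀ (nth stabiliserMatrices) (nth stabiliserInverses) refl refl refl pair-normal
  basis-done : ∀ A B C D → Contains A (1 ∷ 3 ∷ 9 ∷ 27 ∷ []) → CountTransfer A B C D
  basis-done = classify-onto A₀ (1 ∷ 3 ∷ 9 ∷ 27 ∷ []) 6 candidatesA classesA refl refl refl refl refl A-normal
  basis-e₄ : ∀ A B C D → Contains A (1 ∷ 3 ∷ 9 ∷ []) → CountTransfer A B C D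
  basis-e₄ = extend (1 ∷ 3 ∷ 9 ∷ []) 27 (spanᵇ 3) (1 ∷ 2 ∷ 3 ∷ 6 ∷ 9 ∷ 18 ∷ 13 ∷ 14 ∷ 16 ∷ 17 ∷ 22 ∷ 23 ∷ 25 ∷ 26 ∷ [])
    (nth matrices₄) (nth inverses₄) refl (from-yes (14 ℕₚ.<? 20))
    refl refl basis-done
  basis-e₃ : ∀ A B C D → Contains A (1 ∷ 3 ∷ []) → CountTransfer A B C D
  basis-e₃ = extend (1 ∷ 3 ∷ []) 9 (spanᵇ 2) (1 ∷ 2 ∷ 3 ∷ 6 ∷ []) (nth matrices₃) (nth inverses₃)
    refl (from-yes (4 ℕₚ.<? 20)) refl refl basis-e₄
  basis-e₂ : ∀ A B C D → Contains A (1 ∷ []) → CountTransfer A B C D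
  basis-e₂ = extend (1 ∷ []) 3 (spanᵇ 1) (1 ∷ 2 ∷ []) (nth matrices₂) (nth inverses₂)
    refl (from-yes (2 ℕₚ.<? 20)) refl refl basis-e₃
  basis-e₁ : ∀ A B C D → Contains A [] → CountTransfer A B C D
  basis-e₁ = extend [] 1 (spanᵇ 0) [] (nth matrices₁) (nth inverses₁) refl (from-yes (0 ℕₚ.<? 20)) refl refl basis-e₂

lemma3p9 : (A B C D : PSet) → IsPartition0 A B C D →
    ((Completable 1 A B ⊎ Completable 2 A B) → (Completable 1 C D ⊎ Completable 2 C D))
    × (Completable 1 A B ⇔ Completable 1 C D)
    × (Completable 2 A B ⇔ Completable 2 C D)
lemma3p9 A B C D part =
  Sum.map (forward 1) (forward 2) , mk⇔ (forward 1) (backward 1) , mk⇔ (forward 2) (backward 2)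
  where
  forward : ∀ k → Completable k A B → Completable k C D
  forward = count-transfer A B C D part
  backward : ∀ k → Completable k C D → Completable k A B
  backward = count-transfer C D A B (partition-swapPairs part)
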